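{- Let $\lambda$ be a partition whose $2$-quotient satisfies the shifted condition, and let $S\in\mathsf{MSShDT}(\lambda)$. Then \[\sum_{\substack{T\in\mathsf{SSShDT}(\lambda)\\ \mathrm{std}(T)=S}}x^{\mathrm{wt}(T)}=F^B_{\mathrm{Des}(S)},\] where $F^B$ is taken in degree $n$, the number of dominoes of $S$.
   Context: Young diagrams are in English convention. The $2$-quotient of $\lambda=(\lambda_1,\dots,\lambda_k)$: let $\lambda^\star=(\lambda_i+k-i)_i$; let $w$ be obtained from $\lambda^\star$ by replacing its odd parts, from right to left, by $1,3,5,\dots$ and its even parts, from right to left, by $0,2,4,\dots$; $\mu$ (resp. $\nu$) is obtained by subtracting position by position the even (resp. odd) entries of $w$ from the even (resp. odd) entries of $\lambda^\star$, dividing by $2$, removing zeros. Shifted condition: $\mu=(\mu_1,\dots,\mu_p)$, $\nu=(\nu_1,\dots,\nu_q)$ with $\mu_p\ge p$, $\nu_q\ge q$. A domino tiling of $\lambda$ is shifted if there is no vertical domino $d$ on the main diagonal such that all dominoes left of and adjacent to $d$ are strictly below the main diagonal. A semistandard shifted domino tableau of shape $\lambda$ is, for some shifted tiling, a filling of the dominoes lying weakly above the main diagonal with entries from the totally ordered set $0<1'<1<2'<2<\cdots$ such that (1) entries weakly increase left to right along rows and top to bottom in columns; (2) each row contains at most one $i'$ and each column at most one $i$ (for each $i$); (3) the northwest-most domino may contain $0$ only if it is horizontal. $\mathsf{SSShDT}(\lambda)$ is their set; $\mathrm{wt}_i(T)$ is the number of entries equal to $i$ or $i'$ ($\mathrm{wt}_0(T)$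 = number of $0$'s), and $x^{\mathrm{wt}(T)}=\prod_{i\ge0}x_i^{\mathrm{wt}_i(T)}$. A standard shifted domino tableau is a bijective filling of the dominoes weakly above the diagonal in a shifted tiling with $[m]$ ($m$ = number of those dominoes), strictly increasing along rows and down columns; a marked one additionally has each entry primed or unprimed; $\mathsf{MSShDT}(\lambda)$ is the set of these. $\mathrm{dom}_i(S)$ is the domino containing $i$ or $i'$, and $\mathrm{demark}(S)$ removes primes. For an unmarked $Q$ with $n$ dominoes, $i\in[0,n-1]$ is a descent if $i=0$ and $\mathrm{dom}_1(Q)$ is vertical, or $i>0$ and $\mathrm{dom}_{i+1}(Q)$ is strictly lower than $\mathrm{dom}_i(Q)$ (both its cells in rows strictly below both cells of $\mathrm{dom}_i(Q)$). For marked $S$, $i\in[0,n-1]$ is a descent if: $i=0$ and ($1'$ is in $S$ or $\mathrm{dom}_1(S)$ is vertical); or $i>0$, $i$ is in $S$ unprimed and $i$ is a descent of $\mathrm{demark}(S)$; or $i>0$, $(i+1)'$ is in $S$ and $i$ is not a descent of $\mathrm{demark}(S)$. $\mathrm{Des}(S)$ is the descent set. Standardization $\mathrm{std}(T)\in\mathsf{MSShDT}(\lambda)$ of $T\in\mathsf{SSShDT}(\lambda)$: let $n_1<\cdots<n_r$ be the positive $i$ with $\mathrm{wt}_i(T)\ne0$; replace the $0$ entries from left to right by $1,\dots,\mathrm{wt}_0(T)$; then replace the entries $n_1',n_1$ by $\mathrm{wt}_0(T)+1,\dots,\mathrm{wt}_0(T)+\mathrm{wt}_{n_1}(T)$, primed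 entries becoming primed integers and unprimed becoming unprimed, first the entries $n_1'$ from top to bottom and then the entries $n_1$ from left to right; continue likewise with $n_2$, etc. $F^B_I=\sum x_{i_1}\cdots x_{i_n}$ over integers $0=i_0\le i_1\le\cdots\le i_n$ with $i_j<i_{j+1}$ whenever $j\in I$. -}

module Defs where

open import Data.Nat using (ℕ; zero; suc; _+_; _*_; _∸_; _≤_; _<_; ⌊_/2⌋; _≡ᵇ_; _<ᵇ_)
open import Data.Bool using (Bool; true; false; if_then_else_; _∧_; _∨_; not)
open import Data.List using (List; []; _∷_; length; map)
open import Data.List.Membership.Propositional using (_∈_)
open import Data.List.Relation.Unary.All using (All)
open import Data.List.Relation.Unary.Any using (Any)
open import Data.List.Relation.Unary.AllPairs using (AllPairs)
open import Data.Maybe using (Maybe; just; nothing)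
open import Data.Product using (Σ; ∃; _×_; _,_; proj₁; proj₂)
open import Data.Sum using (_⊎_)
open import Data.Unit using (⊤)
open import Data.Empty using (⊥)
open import Relation.Binary.PropositionalEquality using (_≡_; _≢_)
open import Relation.Nullary using (¬_)

IsPartition : List ℕ → Set
IsPartition []           = ⊤
IsPartition (x ∷ [])     = 0 < x
IsPartition (x ∷ y ∷ ys) = y ≤ x × IsPartition (y ∷ ys)

-- part λ r = λ_{r+1} (0-indexed row r), 0 beyond the last row
part : List ℕ → ℕ → ℕ
part []       _       = 0
part (x ∷ xs) zero    = x
part (x ∷ xs) (suc i) = part xs i

-- Cells are (row , column), both 0-indexed, English convention.
Cell : Set
Cell = ℕ × ℕ

InShape : List ℕ → Cell → Set
InShape la (r , c) = c < part la r

isEven : ℕ → Bool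
isEven zero          = true
isEven (suc zero)    = false
isEven (suc (suc n)) = isEven n

-- λ* = (λ_i + k - i)_i
star : List ℕ → List ℕ
star la = go la (length la)
  where
  go : List ℕ → ℕ → List ℕ
  go []       _ = []
  go (x ∷ xs) k = (x + (k ∸ 1)) ∷ go xs (k ∸ 1)

eqB : Bool → Bool → Bool
eqB true  b = b
eqB false b = not b

countPar : Bool → List ℕ → ℕ
countPar b []       = 0
countPar b (x ∷ xs) = if eqB (isEven x) b then suc (countPar b xs) else countPar b xs

-- the word w: odd parts replaced right-to-left by 1,3,5,…, even parts by 0,2,4,…
wword : List ℕ → List ℕ
wword []       = []
wword (x ∷ xs) = (if isEven x then 2 * countPar true xs else suc (2 * countPar false xs)) ∷ wword xs

halfDiffs : Bool → List ℕ → List ℕ → List ℕ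
halfDiffs b (x ∷ xs) (y ∷ ys) =
  if eqB (isEven x) b then ⌊ x ∸ y /2⌋ ∷ halfDiffs b xs ys else halfDiffs b xs ys
halfDiffs b _ _ = []

removeZeros : List ℕ → List ℕ
removeZeros []             = []
removeZeros (zero ∷ xs)    = removeZeros xs
removeZeros (suc x ∷ xs)   = suc x ∷ removeZeros xs

quotμ quotν : List ℕ → List ℕ
quotμ la = removeZeros (halfDiffs true  (star la) (wword (star la)))
quotν la = removeZeros (halfDiffs false (star la) (wword (star la)))

lastOf : ℕ → List ℕ → ℕ
lastOf x []       = x
lastOf x (y ∷ ys) = lastOf y ys

ShiftedPart : List ℕ → Set
ShiftedPart []       = ⊤
ShiftedPart (x ∷ xs) = length (x ∷ xs) ≤ lastOf x xs

ShiftedQuotient : List ℕ → Set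
ShiftedQuotient la = ShiftedPart (quotμ la) × ShiftedPart (quotν la)

data Ori : Set where
  hor ver : Ori

record Domino : Set where
  constructor dom
  field
    row col : ℕ      -- the north-west cell of the domino
    ori     : Ori
open Domino public

cell₁ cell₂ : Domino → Cell
cell₁ d = row d , col d
cell₂ (dom r c hor) = r , suc c
cell₂ (dom r c ver) = suc r , c

Covers : Domino → Cell → Set
Covers d x = (cell₁ d ≡ x) ⊎ (cell₂ d ≡ x)

bottomRow : Domino → ℕ
bottomRow (dom r c hor) = r
bottomRow (dom r c ver) = suc r

Disjoint : Domino → Domino → Set
Disjoint d e = ∀ x → Covers d x → Covers e x → ⊥

-- strict lexicographic order on north-west cells (used only to make the
-- list representation of a tiling canonical)
LexLess : Domino → Domino → Set
LexLess d e = (row d < row e) ⊎ ((row d ≡ row e) × (col d < col e))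

Tiling : List ℕ → List Domino → Set
Tiling la ds =
  All (λ d → InShape la (cell₁ d) × InShape la (cell₂ d)) ds
  × AllPairs (λ d e → Disjoint d e × LexLess d e) ds
  × (∀ r c → InShape la (r , c) → Any (λ d → Covers d (r , c)) ds)

WeaklyAboveCell : Cell → Set
WeaklyAboveCell (r , c) = r ≤ c

WeaklyAbove : Domino → Set
WeaklyAbove d = WeaklyAboveCell (cell₁ d) ⊎ WeaklyAboveCell (cell₂ d)

StrictlyBelow : Domino → Set
StrictlyBelow d = ¬ WeaklyAbove d

OnDiagonal : Domino → Set
OnDiagonal d = (row d ≡ col d) ⊎ (proj₁ (cell₂ d) ≡ proj₂ (cell₂ d))

LeftAdjacent : Domino → Domino → Set
LeftAdjacent e d =
  ∃ λ r → ∃ λ c → Covers d (r , suc c) × Covers e (r , c)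

ShiftedTiling : List Domino → Set
ShiftedTiling ds =
  ∀ d → d ∈ ds → ori d ≡ ver → OnDiagonal d → 1 ≤ col d →
    ¬ (∀ e → e ∈ ds → LeftAdjacent e d → StrictlyBelow e)

-- Fillings: a filling is a tiling listed with a label on each domino,
-- `just a` exactly on the dominoes weakly above the diagonal.

Filling : Set → Set
Filling A = List (Domino × Maybe A)

tilingOf : {A : Set} → Filling A → List Domino
tilingOf = map proj₁

LabeledOK : {A : Set} → Domino × Maybe A → Set
LabeledOK (d , m) = (WeaklyAbove d → ∃ λ a → m ≡ just a) × (StrictlyBelow d → m ≡ nothing)

ShiftedFilling : {A : Set} → List ℕ → Filling A → Set
ShiftedFilling la F = Tiling la (tilingOf F) × ShiftedTiling (tilingOf F) × All LabeledOK F

RowRel ColRel : {A : Set} → (A → A → Set) → Filling A → Set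
RowRel R F = ∀ {d a e b} → (d , just a) ∈ F → (e , just b) ∈ F → d ≢ e →
  ∀ r c → Covers d (r , c) → Covers e (r , suc c) → R a b
ColRel R F = ∀ {d a e b} → (d , just a) ∈ F → (e , just b) ∈ F → d ≢ e →
  ∀ r c → Covers d (r , c) → Covers e (suc r , c) → R a b

ShareRow ShareCol : Domino → Domino → Set
ShareRow d e = ∃ λ r → ∃ λ c → ∃ λ c' → Covers d (r , c) × Covers e (r , c')
ShareCol d e = ∃ λ c → ∃ λ r → ∃ λ r' → Covers d (r , c) × Covers e (r' , c)

-- Semistandard shifted domino tableaux.
-- Entries 0 < 1' < 1 < 2' < 2 < … are coded by ℕ: 0 ↦ 0, i' ↦ 2i-1, i ↦ 2i.

val : ℕ → ℕ
val e = ⌊ suc e /2⌋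

primedB : ℕ → Bool
primedB e = not (isEven e)

SSShDT : List ℕ → Filling ℕ → Set
SSShDT la T =
  ShiftedFilling la T
  × RowRel _≤_ T × ColRel _≤_ T
  × (∀ {d e a} → (d , just a) ∈ T → (e , just a) ∈ T → d ≢ e → primedB a ≡ true → ¬ ShareRow d e)
  × (∀ {d e a} → (d , just a) ∈ T → (e , just a) ∈ T → d ≢ e → primedB a ≡ false → ¬ ShareCol d e)
  × (∀ {d} → (d , just 0) ∈ T → Covers d (0 , 0) → ori d ≡ hor)

wt : Filling ℕ → ℕ → ℕ
wt [] i = 0
wt ((d , nothing) ∷ T) i = wt T i
wt ((d , just e) ∷ T) i = if val e ≡ᵇ i then suc (wt T i) else wt T i

-- Marked standard shifted domino tableaux: labels (k , primed?)

MLabel : Set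
MLabel = ℕ × Bool

labels : Filling MLabel → List ℕ
labels [] = []
labels ((d , nothing) ∷ S) = labels S
labels ((d , just (k , _)) ∷ S) = k ∷ labels S

nDominoes : Filling MLabel → ℕ
nDominoes S = length (labels S)

MSShDT : List ℕ → Filling MLabel → Set
MSShDT la S =
  ShiftedFilling la S
  × All (λ k → 1 ≤ k × k ≤ nDominoes S) (labels S)
  × AllPairs _≢_ (labels S)
  × RowRel (λ a b → proj₁ a < proj₁ b) S
  × ColRel (λ a b → proj₁ a < proj₁ b) S

StrictlyLower : Domino → Domino → Set
StrictlyLower d' d = bottomRow d < row d'

UDes : Filling MLabel → ℕ → Set
UDes S i = ∃ λ d → ∃ λ b → ∃ λ d' → ∃ λ b' →
  (d , just (i , b)) ∈ S × (d' , just (suc i , b')) ∈ S × StrictlyLower d' d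

Des : Filling MLabel → ℕ → Set
Des S zero =
  (∃ λ d → (d , just (1 , true)) ∈ S)
  ⊎ (∃ λ d → ∃ λ b → (d , just (1 , b)) ∈ S × ori d ≡ ver)
Des S (suc j) =
  ((∃ λ d → (d , just (suc j , false)) ∈ S) × UDes S (suc j))
  ⊎ ((∃ λ d → (d , just (suc (suc j) , true)) ∈ S) × ¬ UDes S (suc j))

countF : (Domino → ℕ → Bool) → Filling ℕ → ℕ
countF p [] = 0
countF p ((d , nothing) ∷ T) = countF p T
countF p ((d , just e) ∷ T) = if p d e then suc (countF p T) else countF p T

lexB : ℕ → ℕ → ℕ → ℕ → Bool
lexB a b a' b' = (a <ᵇ a') ∨ ((a ≡ᵇ a') ∧ (b <ᵇ b'))

-- the new (demarked) entry of the domino d carrying code e: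
-- all entries of smaller value come first; within value v, first the
-- v' from top to bottom, then the v from left to right
stdNum : Filling ℕ → Domino → ℕ → ℕ
stdNum T d e =
  suc (countF (λ d' e' → val e' <ᵇ val e) T
       + (if primedB e
          then countF (λ d' e' → (val e' ≡ᵇ val e) ∧ primedB e'
                                 ∧ lexB (row d') (col d') (row d) (col d)) T
          else (countF (λ d' e' → (val e' ≡ᵇ val e) ∧ primedB e') T
                + countF (λ d' e' → (val e' ≡ᵇ val e) ∧ not (primedB e')
                                 ∧ lexB (col d') (row d') (col d) (row d)) T)))

std : Filling ℕ → Filling MLabel
std T = map f T
  where
  f : Domino × Maybe ℕ → Domino × Maybe MLabel
  f (d , nothing) = d , nothing
  f (d , just e)  = d , just (stdNum T d e , primedB e)

-- F^B_I in degree n: the monomials x_{i₁}⋯x_{iₙ} with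
-- 0 = i₀ ≤ i₁ ≤ ⋯ ≤ iₙ and i_j < i_{j+1} whenever j ∈ I.

-- FBSeq I j prev is : `is` continues the sequence after i_j = prev
FBSeq : (ℕ → Set) → ℕ → ℕ → List ℕ → Set
FBSeq I j prev []       = ⊤
FBSeq I j prev (x ∷ xs) = prev ≤ x × (I j → prev < x) × FBSeq I (suc j) x xs

FBIndex : (ℕ → Set) → ℕ → List ℕ → Set
FBIndex I n is = length is ≡ n × FBSeq I 0 0 is

-- exponent of x_k in x_{i₁}⋯x_{iₙ}
mult : List ℕ → ℕ → ℕ
mult [] k = 0
mult (x ∷ xs) k = if x ≡ᵇ k then suc (mult xs k) else mult xs k

-- Equality of generating functions  Σ_{x ∈ P} x^{wP x} = Σ_{y ∈ Q} x^{wQ y}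
-- (all coefficients finite), expressed as a weight-preserving bijection
-- between P and Q.

GFEq : {X Y : Set} → (X → Set) → (Y → Set) → (X → ℕ → ℕ) → (Y → ℕ → ℕ) → Set
GFEq {X} {Y} P Q wP wQ =
  Σ (X → Y) λ f →
    (∀ x → P x → Q (f x) × (∀ k → wP x k ≡ wQ (f x) k))
    × (∀ x x' → P x → P x' → f x ≡ f x' → x ≡ x')
    × (∀ y → Q y → ∃ λ x → P x × f x ≡ y)

{-# OPTIONS --safe #-}
-- Standardization numbers the entries of T in the order: smaller values first;
-- within a value v, the v′ from top to bottom, then the v from left to right. Hence
-- std T = S says that T is obtained from S by writing i_k (primed iff k is primed in S)
-- on the domino labelled k, where i₁ ≤ ⋯ ≤ iₙ lists the values of T in the order of
-- the labels of S, and that this order agrees with the labels. So T ↦ (i₁, …, iₙ) is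
-- injective and preserves weights. If i_k = i_{k+1} at a descent k of S, the two
-- entries would be equal unprimed entries in one column or equal primed entries in one
-- row, so i_k < i_{k+1}. Conversely, between two descents the labels of S run through
-- unprimed dominoes moving strictly right and primed dominoes moving strictly down;
-- hence every F^B_{Des S}-sequence fills S to a semistandard tableau standardizing to S.

module Submission where

open import Defs
open import Data.Bool using (Bool; true; false; T; if_then_else_; _∧_; _∨_; not)
open import Data.Bool.Properties using (T-∧; ∧-distribˡ-∨)
open import Data.Empty using (⊥; ⊥-elim)
open import Data.List using (List; []; _∷_; length; map; applyUpTo; applyDownFrom)
open import Data.List.Membership.Propositional using (_∈_; _─_; find)
open import Data.List.Membership.Propositional.Properties
  using (∈-map⁺; ∈-map⁻; ∈-applyDownFrom⁺; ∈-applyDownFrom⁻)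
open import Data.List.Properties
  using (length-removeAt′; length-applyDownFrom; length-applyUpTo; map-cong; map-∘; map-id-local;
         map-applyUpTo; ∷-injectiveˡ; ∷-injectiveʳ)
open import Data.List.Relation.Unary.All as All using (All; []; _∷_)
open import Data.List.Relation.Unary.All.Properties as AllP using (─⁺; ¬Any⇒All¬)
open import Data.List.Relation.Unary.AllPairs using (AllPairs; []; _∷_)
open import Data.List.Relation.Unary.AllPairs.Properties using (applyUpTo⁺₁)
open import Data.List.Relation.Unary.Any using (here; there; index)
open import Data.List.Relation.Unary.Any.Properties as AnyP using ()
open import Data.List.Relation.Unary.Unique.Propositional using (Unique)
open import Data.Maybe using (Maybe; just; nothing)
open import Data.Nat
open import Data.Nat.Properties
open import Data.List.Membership.DecPropositional _≟_ using (_∈?_)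
open import Data.Product using (_×_; _,_; proj₁; proj₂; uncurry; ∃; ∃-syntax)
open import Data.Sum using (_⊎_; inj₁; inj₂)
open import Function using (_∘_; _⇔_; mk⇔; Equivalence; case_of_)
open import Relation.Binary.Definitions using (tri<; tri≈; tri>)
open import Relation.Binary.PropositionalEquality
open import Relation.Nullary using (¬_; yes; no; _⊎-dec_)
open import Relation.Nullary.Decidable using (T?)
open import Relation.Nullary.Reflects using (Reflects; ofʸ; ofⁿ; fromEquivalence)

private variable
  A B : Set

T-injective : ∀ {a b} → (T a → T b) → (T b → T a) → a ≡ b
T-injective {false} {false} _ _ = refl
T-injective {false} {true}  _ b⇒a = ⊥-elim (b⇒a _)
T-injective {true}  {false} a⇒b _ = ⊥-elim (a⇒b _)
T-injective {true}  {true}  _ _ = refl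

≡ᵇ-reflects-≡ : ∀ m n → Reflects (m ≡ n) (m ≡ᵇ n)
≡ᵇ-reflects-≡ m n = fromEquivalence (≡ᵇ⇒≡ m n) (≡⇒≡ᵇ m n)

countᵇ : (A → Bool) → List A → ℕ
countᵇ p []       = 0
countᵇ p (x ∷ xs) = if p x then suc (countᵇ p xs) else countᵇ p xs

countᵇ-cong : {p q : A → Bool} (xs : List A) → (∀ {x} → x ∈ xs → p x ≡ q x) →
              countᵇ p xs ≡ countᵇ q xs
countᵇ-cong []       _   = refl
countᵇ-cong {p = p} (x ∷ xs) p≡q rewrite p≡q (here refl) | countᵇ-cong {p = p} xs (p≡q ∘ there) = refl

countᵇ-map : (p : B → Bool) (f : A → B) (xs : List A) → countᵇ p (map f xs) ≡ countᵇ (p ∘ f) xs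
countᵇ-map p f []       = refl
countᵇ-map p f (x ∷ xs) rewrite countᵇ-map p f xs = refl

countᵇ-mono : {p q : A → Bool} (xs : List A) → (∀ {x} → x ∈ xs → T (p x) → T (q x)) →
              countᵇ p xs ≤ countᵇ q xs
countᵇ-mono []       _ = z≤n
countᵇ-mono {p = p} {q} (x ∷ xs) p⇒q with p x in px | q x in qx | countᵇ-mono xs (p⇒q ∘ there)
... | true  | true  | ih = s≤s ih
... | false | true  | ih = m≤n⇒m≤1+n ih
... | false | false | ih = ih
... | true  | false | _  = ⊥-elim (subst T qx (p⇒q (here refl) (subst T (sym px) _)))

countᵇ-mono-< : {p q : A → Bool} (xs : List A) → (∀ {x} → x ∈ xs → T (p x) → T (q x)) →
                ∀ {y} → y ∈ xs → ¬ T (p y) → T (q y) → countᵇ p xs < countᵇ q xs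
countᵇ-mono-< {p = p} {q} (x ∷ xs) p⇒q (here refl) ¬py qy with p x | q x
... | false | true  = s≤s (countᵇ-mono xs (p⇒q ∘ there))
... | true  | _     = ⊥-elim (¬py _)
countᵇ-mono-< {p = p} {q} (x ∷ xs) p⇒q (there y∈xs) ¬py qy
  with p x in px | q x in qx | countᵇ-mono-< xs (p⇒q ∘ there) y∈xs ¬py qy
... | true  | true  | ih = s≤s ih
... | false | true  | ih = m≤n⇒m≤1+n ih
... | false | false | ih = ih
... | true  | false | _  = ⊥-elim (subst T qx (p⇒q (here refl) (subst T (sym px) _)))

countᵇ-∨ : (p q : A → Bool) (xs : List A) → (∀ x → ¬ (T (p x) × T (q x))) →
           countᵇ (λ x → p x ∨ q x) xs ≡ countᵇ p xs + countᵇ q xs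
countᵇ-∨ p q []       _ = refl
countᵇ-∨ p q (x ∷ xs) disjoint with p x | q x | disjoint x | countᵇ-∨ p q xs disjoint
... | true  | true  | d | _  = ⊥-elim (d (_ , _))
... | true  | false | _ | ih = cong suc ih
... | false | true  | _ | ih = trans (cong suc ih) (sym (+-suc _ _))
... | false | false | _ | ih = ih

∈⇒countᵇ>0 : (p : A → Bool) {xs : List A} {y : A} → y ∈ xs → T (p y) → 0 < countᵇ p xs
∈⇒countᵇ>0 p {x ∷ xs} (here refl) py with p x
... | true = z<s
∈⇒countᵇ>0 p {x ∷ xs} (there y∈xs) py with p x
... | true  = z<s
... | false = ∈⇒countᵇ>0 p y∈xs py

countᵇ>0⇒∈ : (p : A → Bool) (xs : List A) → 0 < countᵇ p xs → ∃[ y ] y ∈ xs × T (p y)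
countᵇ>0⇒∈ p (x ∷ xs) pos with p x in px
... | true  = x , here refl , subst T (sym px) _
... | false = let y , y∈xs , py = countᵇ>0⇒∈ p xs pos in y , there y∈xs , py

countᵇ-all : (p : A → Bool) (xs : List A) → (∀ {x} → x ∈ xs → T (p x)) → countᵇ p xs ≡ length xs
countᵇ-all p []       _   = refl
countᵇ-all p (x ∷ xs) all with p x | all (here refl)
... | true | _ = cong suc (countᵇ-all p xs (all ∘ there))

countᵇ-─ : (p : A → Bool) (xs : List A) {x : A} (x∈xs : x ∈ xs) →
           countᵇ p xs ≡ countᵇ p (x ∷ (xs ─ x∈xs))
countᵇ-─ p (y ∷ xs) (here refl) = refl
countᵇ-─ p (y ∷ xs) {x} (there x∈xs) rewrite countᵇ-─ p xs x∈xs with p x | p y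
... | true  | true  = refl
... | true  | false = refl
... | false | true  = refl
... | false | false = refl

unique-─ : {xs : List A} {x : A} → Unique xs → (x∈xs : x ∈ xs) → Unique (x ∷ (xs ─ x∈xs))
unique-─ (x≢xs ∷ u) (here refl) = x≢xs ∷ u
unique-─ {xs = y ∷ xs} (y≢xs ∷ u) (there x∈xs) with unique-─ u x∈xs
... | x≢rest ∷ u′ = ((λ x≡y → All.lookup y≢xs x∈xs (sym x≡y)) ∷ x≢rest) ∷ ─⁺ x∈xs y≢xs ∷ u′

InRange : ℕ → ℕ → Set
InRange n k = 1 ≤ k × k ≤ n

private
  narrowRange : ∀ {m xs} → All (InRange (suc m)) xs → All (suc m ≢_) xs → All (InRange m) xs
  narrowRange r ≢m = All.zipWith (λ ((1≤k , k≤1+m) , 1+m≢k) → 1≤k , ≤-pred (≤∧≢⇒< k≤1+m (≢-sym 1+m≢k))) (r , ≢m)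

unique-inRange⇒length≤ : ∀ m {xs} → Unique xs → All (InRange m) xs → length xs ≤ m
unique-inRange⇒length≤ zero    {[]}     _ _                    = z≤n
unique-inRange⇒length≤ zero    {x ∷ xs} _ ((1≤x , x≤0) ∷ _)    = ⊥-elim (<⇒≱ 1≤x x≤0)
unique-inRange⇒length≤ (suc m) {xs}     u r with suc m ∈? xs
... | no  m+1∉xs = m≤n⇒m≤1+n (unique-inRange⇒length≤ m u (narrowRange r (¬Any⇒All¬ xs m+1∉xs)))
... | yes m+1∈xs with unique-─ u m+1∈xs
...   | m+1∉rest ∷ u′ = begin
  length xs                 ≡⟨ length-removeAt′ xs (index m+1∈xs) ⟩
  suc (length (xs ─ m+1∈xs)) ≤⟨ s≤s (unique-inRange⇒length≤ m u′ (narrowRange (─⁺ m+1∈xs r) m+1∉rest)) ⟩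
  suc m                     ∎
  where open ≤-Reasoning

record Enumerates (n : ℕ) (xs : List ℕ) : Set where
  field
    unique   : Unique xs
    inRange  : All (InRange n) xs
    length≡n : length xs ≡ n

countᵇ-enumeration : (p : ℕ → Bool) {n : ℕ} {xs : List ℕ} → Enumerates n xs →
                     countᵇ p xs ≡ countᵇ p (applyDownFrom suc n)
countᵇ-enumeration p {zero}  {[]} _ = refl
countᵇ-enumeration p {suc m} {xs} record { unique = u ; inRange = r ; length≡n = len } with suc m ∈? xs
... | no  m+1∉xs = ⊥-elim (<-irrefl len (s≤s (unique-inRange⇒length≤ m u (narrowRange r (¬Any⇒All¬ xs m+1∉xs)))))
... | yes m+1∈xs with unique-─ u m+1∈xs
...   | m+1∉rest ∷ u′ = begin
  countᵇ p xs                          ≡⟨ countᵇ-─ p xs m+1∈xs ⟩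
  countᵇ p (suc m ∷ (xs ─ m+1∈xs))     ≡⟨ cong (λ c → if p (suc m) then suc c else c) (countᵇ-enumeration p rest) ⟩
  countᵇ p (applyDownFrom suc (suc m)) ∎
  where
  open ≡-Reasoning
  rest : Enumerates m (xs ─ m+1∈xs)
  rest = record
    { unique   = u′
    ; inRange  = narrowRange (─⁺ m+1∈xs r) m+1∉rest
    ; length≡n = suc-injective (trans (sym (length-removeAt′ xs (index m+1∈xs))) len)
    }

applyUpTo-enumerates : ∀ n → Enumerates n (applyUpTo suc n)
applyUpTo-enumerates n = record
  { unique   = applyUpTo⁺₁ suc n (λ i<j _ → <⇒≢ (s<s i<j))
  ; inRange  = AllP.applyUpTo⁺₁ suc n (λ i<n → s≤s z≤n , i<n)
  ; length≡n = length-applyUpTo suc n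
  }

∈-enumeration : ∀ {n xs} → Enumerates n xs → ∀ {k} → InRange n k → k ∈ xs
∈-enumeration {n} {xs} enum {suc k} (_ , k<n) with countᵇ>0⇒∈ (_≡ᵇ suc k) xs
  (subst (0 <_) (sym (countᵇ-enumeration (_≡ᵇ suc k) enum))
     (∈⇒countᵇ>0 (_≡ᵇ suc k) (∈-applyDownFrom⁺ suc k<n) (≡⇒≡ᵇ (suc k) (suc k) refl)))
... | y , y∈xs , y≡k = subst (_∈ xs) (≡ᵇ⇒≡ y (suc k) y≡k) y∈xs

countᵇ-<ᵇ-downFrom : ∀ n k → k ≤ suc n → countᵇ (_<ᵇ k) (applyDownFrom suc n) ≡ pred k
countᵇ-<ᵇ-downFrom zero    zero          _ = refl
countᵇ-<ᵇ-downFrom zero    (suc zero)    _ = refl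
countᵇ-<ᵇ-downFrom zero    (suc (suc k)) (s≤s ())
countᵇ-<ᵇ-downFrom (suc n) k k≤n+2 with suc n <ᵇ k | <ᵇ-reflects-< (suc n) k
... | true  | ofʸ n+1<k rewrite ≤-antisym k≤n+2 n+1<k =
  cong suc (trans (countᵇ-all (_<ᵇ suc (suc n)) _ below) (length-applyDownFrom suc n))
  where
  below : ∀ {j} → j ∈ applyDownFrom suc n → T (j <ᵇ suc (suc n))
  below j∈ with i , i<n , refl ← ∈-applyDownFrom⁻ suc j∈ = <⇒<ᵇ (s<s (m<n⇒m<1+n i<n))
... | false | ofⁿ n+1≮k = countᵇ-<ᵇ-downFrom n k (≮⇒≥ n+1≮k)

unique-map-injective : ∀ {A B : Set} (f : A → B) {xs : List A} → Unique (map f xs) →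
                       ∀ {x y} → x ∈ xs → y ∈ xs → f x ≡ f y → x ≡ y
unique-map-injective f {_ ∷ xs} _            (here refl) (here refl) _   = refl
unique-map-injective f {_ ∷ xs} (fx≢ ∷ _)    (here refl) (there y∈)  fxy = ⊥-elim (All.lookup fx≢ (∈-map⁺ f y∈) fxy)
unique-map-injective f {_ ∷ xs} (fy≢ ∷ _)    (there x∈)  (here refl) fxy = ⊥-elim (All.lookup fy≢ (∈-map⁺ f x∈) (sym fxy))
unique-map-injective f {_ ∷ xs} (_ ∷ unique) (there x∈)  (there y∈)  fxy = unique-map-injective f unique x∈ y∈ fxy

module Ranking {A : Set} (_≺_ : A → A → Bool)
  (≺-irrefl : ∀ x → ¬ T (x ≺ x)) (≺-trans : ∀ x y z → T (x ≺ y) → T (y ≺ z) → T (x ≺ z))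
  (label : A → ℕ) {n : ℕ} (xs : List A) (labels-enumerate : Enumerates n (map label xs))
  where

  open Enumerates labels-enumerate

  rank : A → ℕ
  rank x = suc (countᵇ (_≺ x) xs)

  private
    rank-mono : ∀ {x y} → y ∈ xs → T (y ≺ x) → rank y < rank x
    rank-mono {x} {y} y∈xs y≺x =
      s≤s (countᵇ-mono-< xs (λ {z} _ z≺y → ≺-trans z y x z≺y y≺x) y∈xs (≺-irrefl y) y≺x)

  rank≡label⇒ordered : (∀ {x} → x ∈ xs → rank x ≡ label x) →
                  (∀ {x y} → x ∈ xs → y ∈ xs → ¬ T (x ≺ y) → ¬ T (y ≺ x) → label x ≡ label y) →
                  ∀ {x y} → x ∈ xs → y ∈ xs → label x < label y → T (x ≺ y)
  rank≡label⇒ordered rank≡label incomparable {x} {y} x∈xs y∈xs lx<ly with T? (x ≺ y) | T? (y ≺ x)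
  ... | yes x≺y | _       = x≺y
  ... | no  x⊀y | yes y≺x =
    ⊥-elim (<-asym lx<ly (subst₂ _<_ (rank≡label y∈xs) (rank≡label x∈xs) (rank-mono y∈xs y≺x)))
  ... | no  x⊀y | no  y⊀x = ⊥-elim (<-irrefl (incomparable x∈xs y∈xs x⊀y y⊀x) lx<ly)

  ordered⇒rank≡label : (∀ {x y} → x ∈ xs → y ∈ xs → label x < label y → T (x ≺ y)) →
                  ∀ {x} → x ∈ xs → rank x ≡ label x
  ordered⇒rank≡label ordered {x} x∈xs = begin
    suc (countᵇ (_≺ x) xs)                                          ≡⟨ cong suc (countᵇ-cong xs ≺x≡<label) ⟩
    suc (countᵇ ((_<ᵇ label x) ∘ label) xs)                         ≡⟨ cong suc (countᵇ-map (_<ᵇ label x) label xs) ⟨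
    suc (countᵇ (_<ᵇ label x) (map label xs))                       ≡⟨ cong suc (countᵇ-enumeration _ labels-enumerate) ⟩
    suc (countᵇ (_<ᵇ label x) (applyDownFrom suc n))                ≡⟨ cong suc (countᵇ-<ᵇ-downFrom n (label x) (m≤n⇒m≤1+n lx≤n)) ⟩
    suc (pred (label x))                                            ≡⟨ suc-pred (label x) {{>-nonZero 1≤lx}} ⟩
    label x                                                         ∎
    where
    open ≡-Reasoning
    1≤lx : 1 ≤ label x
    1≤lx = proj₁ (All.lookup inRange (∈-map⁺ label x∈xs))
    lx≤n : label x ≤ n
    lx≤n = proj₂ (All.lookup inRange (∈-map⁺ label x∈xs))
    ≺x≡<label : ∀ {y} → y ∈ xs → (y ≺ x) ≡ (label y <ᵇ label x)
    ≺x≡<label {y} y∈xs = T-injective (<⇒<ᵇ ∘ below) (ordered y∈xs x∈xs ∘ <ᵇ⇒< (label y) (label x))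
      where
      below : T (y ≺ x) → label y < label x
      below y≺x with <-cmp (label y) (label x)
      ... | tri< ly<lx _ _ = ly<lx
      ... | tri≈ _ ly≡lx _ with refl ← unique-map-injective label unique y∈xs x∈xs ly≡lx = ⊥-elim (≺-irrefl y y≺x)
      ... | tri> _ _ lx<ly = ⊥-elim (≺-irrefl x (≺-trans x y x (ordered x∈xs y∈xs lx<ly) y≺x))

-- The standardization order

record IsStrictTotalᵇ {B : Set} (_<_ : B → B → Bool) : Set where
  field
    irreflexive    : ∀ x → ¬ T (x < x)
    transitive     : ∀ x y z → T (x < y) → T (y < z) → T (x < z)
    incomparable⇒≡ : ∀ x y → ¬ T (x < y) → ¬ T (y < x) → x ≡ y

<ᵇ-isStrictTotal : IsStrictTotalᵇ _<ᵇ_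
<ᵇ-isStrictTotal = record
  { irreflexive    = λ x x<x → <-irrefl refl (<ᵇ⇒< x x x<x)
  ; transitive     = λ x y z x<y y<z → <⇒<ᵇ (<-trans (<ᵇ⇒< x y x<y) (<ᵇ⇒< y z y<z))
  ; incomparable⇒≡ = λ x y x≮y y≮x → ≤-antisym (≮⇒≥ (y≮x ∘ <⇒<ᵇ)) (≮⇒≥ (x≮y ∘ <⇒<ᵇ))
  }

module _ {B : Set} (_⊏_ : B → B → Bool) where

  lexᵇ : ℕ × B → ℕ × B → Bool
  lexᵇ (x , y) (x′ , y′) = (x <ᵇ x′) ∨ ((x ≡ᵇ x′) ∧ (y ⊏ y′))

  lexᵇ-inv : ∀ x y x′ y′ → T (lexᵇ (x , y) (x′ , y′)) → x < x′ ⊎ (x ≡ x′ × T (y ⊏ y′))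
  lexᵇ-inv x y x′ y′ lt with x <ᵇ x′ | <ᵇ-reflects-< x x′ | x ≡ᵇ x′ | ≡ᵇ-reflects-≡ x x′
  ... | true  | ofʸ x<x′ | _    | _        = inj₁ x<x′
  ... | false | _        | true | ofʸ x≡x′ = inj₂ (x≡x′ , lt)

  lexᵇ-fst-≤ : ∀ x y x′ y′ → T (lexᵇ (x , y) (x′ , y′)) → x ≤ x′
  lexᵇ-fst-≤ x y x′ y′ lt with lexᵇ-inv x y x′ y′ lt
  ... | inj₁ x<x′       = <⇒≤ x<x′
  ... | inj₂ (x≡x′ , _) = ≤-reflexive x≡x′

  lexᵇ-fst : ∀ {x x′} y y′ → x < x′ → T (lexᵇ (x , y) (x′ , y′))
  lexᵇ-fst {x} {x′} _ _ x<x′ with x <ᵇ x′ | <ᵇ-reflects-< x x′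
  ... | true  | _        = _
  ... | false | ofⁿ x≮x′ = ⊥-elim (x≮x′ x<x′)

  lexᵇ-snd : ∀ x y y′ → T (y ⊏ y′) → T (lexᵇ (x , y) (x , y′))
  lexᵇ-snd x _ _ y<y′ with x <ᵇ x | x ≡ᵇ x | ≡ᵇ-reflects-≡ x x
  ... | true  | _     | _        = _
  ... | false | true  | _        = y<y′
  ... | false | false | ofⁿ x≢x = ⊥-elim (x≢x refl)

  lexᵇ-isStrictTotal : IsStrictTotalᵇ _⊏_ → IsStrictTotalᵇ lexᵇ
  lexᵇ-isStrictTotal ⊏-sto = record
    { irreflexive    = irreflexive′
    ; transitive     = transitive′
    ; incomparable⇒≡ = incomparable⇒≡′
    }
    where
    open IsStrictTotalᵇ ⊏-sto
    irreflexive′ : ∀ p → ¬ T (lexᵇ p p)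
    irreflexive′ (x , y) lt with lexᵇ-inv x y x y lt
    ... | inj₁ x<x       = <-irrefl refl x<x
    ... | inj₂ (_ , y<y) = irreflexive y y<y
    transitive′ : ∀ p q r → T (lexᵇ p q) → T (lexᵇ q r) → T (lexᵇ p r)
    transitive′ (x , y) (x′ , y′) (x″ , y″) p<q q<r
      with lexᵇ-inv x y x′ y′ p<q | lexᵇ-inv x′ y′ x″ y″ q<r
    ... | inj₁ x<x′          | inj₁ x′<x″          = lexᵇ-fst y y″ (<-trans x<x′ x′<x″)
    ... | inj₁ x<x′          | inj₂ (refl , _)     = lexᵇ-fst y y″ x<x′
    ... | inj₂ (refl , _)    | inj₁ x′<x″          = lexᵇ-fst y y″ x′<x″
    ... | inj₂ (refl , y<y′) | inj₂ (refl , y′<y″) = lexᵇ-snd x y y″ (transitive y y′ y″ y<y′ y′<y″)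
    incomparable⇒≡′ : ∀ p q → ¬ T (lexᵇ p q) → ¬ T (lexᵇ q p) → p ≡ q
    incomparable⇒≡′ (x , y) (x′ , y′) p≮q q≮p with <-cmp x x′
    ... | tri< x<x′ _ _ = ⊥-elim (p≮q (lexᵇ-fst y y′ x<x′))
    ... | tri> _ _ x′<x = ⊥-elim (q≮p (lexᵇ-fst y′ y x′<x))
    ... | tri≈ _ refl _ = cong (x ,_) (incomparable⇒≡ y y′ (p≮q ∘ lexᵇ-snd x y y′) (q≮p ∘ lexᵇ-snd x y′ y))

-- `entry v b` codes v′ if b and v otherwise; there is no 0′, so `entry 0 true` is the unprimed 0.
entry : ℕ → Bool → ℕ
entry zero          _     = 0
entry (suc zero)    true  = 1
entry (suc zero)    false = 2
entry (suc (suc v)) b     = 2 + entry (suc v) b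

val-entry : ∀ v b → val (entry v b) ≡ v
val-entry zero          b     = refl
val-entry (suc zero)    true  = refl
val-entry (suc zero)    false = refl
val-entry (suc (suc v)) b     = cong suc (val-entry (suc v) b)

primedB-entry : ∀ v b → primedB (entry (suc v) b) ≡ b
primedB-entry zero    true  = refl
primedB-entry zero    false = refl
primedB-entry (suc v) b     = primedB-entry v b

entry-val : ∀ e → entry (val e) (primedB e) ≡ e
entry-val zero                = refl
entry-val (suc zero)          = refl
entry-val (suc (suc zero))    = refl
entry-val (suc (suc (suc e))) = cong (2 +_) (entry-val (suc e))

entry≡0⇒val≡0 : ∀ v b → entry v b ≡ 0 → v ≡ 0
entry≡0⇒val≡0 zero          b     _  = refl
entry≡0⇒val≡0 (suc zero)    true  ()
entry≡0⇒val≡0 (suc zero)    false ()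
entry≡0⇒val≡0 (suc (suc v)) b     ()

entry-mono-< : ∀ {v v′} b b′ → v < v′ → entry v b ≤ entry v′ b′
entry-mono-< {zero}          b     b′ _ = z≤n
entry-mono-< {suc zero} {suc zero}     b     b′ (s≤s ())
entry-mono-< {suc zero} {suc (suc v′)} true  b′ _ = s≤s z≤n
entry-mono-< {suc zero} {suc (suc v′)} false b′ _ = s≤s (s≤s z≤n)
entry-mono-< {suc (suc v)} {suc (suc v′)} b b′ (s≤s v<v′) = s≤s (s≤s (entry-mono-< b b′ v<v′))

entry-primed≤unprimed : ∀ v → entry v true ≤ entry v false
entry-primed≤unprimed zero          = z≤n
entry-primed≤unprimed (suc zero)    = s≤s z≤n
entry-primed≤unprimed (suc (suc v)) = s≤s (s≤s (entry-primed≤unprimed (suc v)))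

Position : Set
Position = ℕ × ℕ × ℕ

position : Bool → Domino → Position
position true  d = 0 , row d , col d
position false d = 1 , col d , row d

Key : Set
Key = ℕ × Position

keyOf : Domino → ℕ → Bool → Key
keyOf d v b = v , position b d

key : Domino → ℕ → Key
key d e = keyOf d (val e) (primedB e)

_⊏ᵇ_ : Position → Position → Bool
_⊏ᵇ_ = lexᵇ (lexᵇ _<ᵇ_)

_≺ᵇ_ : Key → Key → Bool
_≺ᵇ_ = lexᵇ _⊏ᵇ_

≺ᵇ-isStrictTotal : IsStrictTotalᵇ _≺ᵇ_
≺ᵇ-isStrictTotal = lexᵇ-isStrictTotal _ (lexᵇ-isStrictTotal _ (lexᵇ-isStrictTotal _ <ᵇ-isStrictTotal))

key-entry : ∀ d v b → primedB (entry v b) ≡ b → key d (entry v b) ≡ keyOf d v b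
key-entry d v b pr rewrite val-entry v b | pr = refl

position-injective : ∀ b b′ d d′ → position b d ≡ position b′ d′ → cell₁ d ≡ cell₁ d′
position-injective true  true  d d′ refl = refl
position-injective false false d d′ refl = refl

key≡⇒cell₁≡ : ∀ d e d′ e′ → key d e ≡ key d′ e′ → cell₁ d ≡ cell₁ d′
key≡⇒cell₁≡ d e d′ e′ eq = position-injective (primedB e) (primedB e′) d d′ (cong proj₂ eq)

keyOf-≺⇒≤ : ∀ d v b d′ v′ b′ → T (keyOf d v b ≺ᵇ keyOf d′ v′ b′) → v ≤ v′
keyOf-≺⇒≤ d v b d′ v′ b′ = lexᵇ-fst-≤ _⊏ᵇ_ v (position b d) v′ (position b′ d′)

private
  sameValue : ∀ v p p′ → T ((v , p) ≺ᵇ (v , p′)) → T (p ⊏ᵇ p′)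
  sameValue v p p′ lt with lexᵇ-inv _⊏ᵇ_ v p v p′ lt
  ... | inj₁ v<v        = ⊥-elim (<-irrefl refl v<v)
  ... | inj₂ (_ , p⊏p′) = p⊏p′

keyOf-≺-unprimed : ∀ d v d′ b′ → T (keyOf d v false ≺ᵇ keyOf d′ v b′) → b′ ≡ false × col d ≤ col d′
keyOf-≺-unprimed d v d′ true  lt with () ← sameValue v (position false d) (position true d′) lt
keyOf-≺-unprimed d v d′ false lt =
  refl , lexᵇ-fst-≤ _<ᵇ_ (col d) (row d) (col d′) (row d′) (sameValue v (position false d) (position false d′) lt)

keyOf-≺-primed : ∀ d v b d′ → T (keyOf d v b ≺ᵇ keyOf d′ v true) → b ≡ true × row d ≤ row d′
keyOf-≺-primed d v false d′ lt with () ← sameValue v (position false d) (position true d′) lt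
keyOf-≺-primed d v true  d′ lt =
  refl , lexᵇ-fst-≤ _<ᵇ_ (row d) (col d) (row d′) (col d′) (sameValue v (position true d) (position true d′) lt)

keyOf-≺⇒entry≤ : ∀ d v b d′ v′ b′ → T (keyOf d v b ≺ᵇ keyOf d′ v′ b′) → entry v b ≤ entry v′ b′
keyOf-≺⇒entry≤ d v b d′ v′ b′ lt with lexᵇ-inv _⊏ᵇ_ v (position b d) v′ (position b′ d′) lt
... | inj₁ v<v′          = entry-mono-< b b′ v<v′
... | inj₂ (refl , p⊏p′) = byPrime b b′ p⊏p′
  where
  byPrime : ∀ b b′ → T (position b d ⊏ᵇ position b′ d′) → entry v b ≤ entry v b′
  byPrime true  true  _ = ≤-refl
  byPrime true  false _ = entry-primed≤unprimed v
  byPrime false false _ = ≤-refl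

key-≺⇒≤ : ∀ d e d′ e′ → T (key d e ≺ᵇ key d′ e′) → e ≤ e′
key-≺⇒≤ d e d′ e′ lt = subst₂ _≤_ (entry-val e) (entry-val e′)
  (keyOf-≺⇒entry≤ d (val e) (primedB e) d′ (val e′) (primedB e′) lt)

keyOf-≺-value : ∀ d v b d′ v′ b′ → v < v′ → T (keyOf d v b ≺ᵇ keyOf d′ v′ b′)
keyOf-≺-value d v b d′ v′ b′ = lexᵇ-fst _⊏ᵇ_ (position b d) (position b′ d′)

keyOf-≺-primed-unprimed : ∀ d v d′ → T (keyOf d v true ≺ᵇ keyOf d′ v false)
keyOf-≺-primed-unprimed d v d′ = lexᵇ-snd _⊏ᵇ_ v (position true d) (position false d′) _

keyOf-≺-primed-rows : ∀ d v d′ → row d < row d′ → T (keyOf d v true ≺ᵇ keyOf d′ v true)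
keyOf-≺-primed-rows d v d′ r<r′ =
  lexᵇ-snd _⊏ᵇ_ v (position true d) (position true d′) (lexᵇ-fst _<ᵇ_ (col d) (col d′) r<r′)

keyOf-≺-unprimed-cols : ∀ d v d′ → col d < col d′ → T (keyOf d v false ≺ᵇ keyOf d′ v false)
keyOf-≺-unprimed-cols d v d′ c<c′ =
  lexᵇ-snd _⊏ᵇ_ v (position false d) (position false d′) (lexᵇ-fst _<ᵇ_ (row d) (row d′) c<c′)

entries : {A : Set} → Filling A → List (Domino × A)
entries []                  = []
entries ((d , nothing) ∷ F) = entries F
entries ((d , just a) ∷ F)  = (d , a) ∷ entries F

module _ {A : Set} where

  ∈-entries⁺ : ∀ {F : Filling A} {d a} → (d , just a) ∈ F → (d , a) ∈ entries F
  ∈-entries⁺ {F = (_ , just _) ∷ _}  (here refl) = here refl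
  ∈-entries⁺ {F = (_ , nothing) ∷ _} (there m)   = ∈-entries⁺ m
  ∈-entries⁺ {F = (_ , just _) ∷ _}  (there m)   = there (∈-entries⁺ m)

  ∈-entries⁻ : ∀ {F : Filling A} {d a} → (d , a) ∈ entries F → (d , just a) ∈ F
  ∈-entries⁻ {F = (_ , nothing) ∷ _} m           = there (∈-entries⁻ m)
  ∈-entries⁻ {F = (_ , just _) ∷ _}  (here refl) = here refl
  ∈-entries⁻ {F = (_ , just _) ∷ _}  (there m)   = there (∈-entries⁻ m)

∈-labels : ∀ {S d k β} → (d , just (k , β)) ∈ S → k ∈ labels S
∈-labels {(_ , just _) ∷ S}  (here refl) = here refl
∈-labels {(_ , nothing) ∷ S} (there m)   = ∈-labels m
∈-labels {(_ , just _) ∷ S}  (there m)   = there (∈-labels m)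

labels≡ : (F : Filling MLabel) → labels F ≡ map (proj₁ ∘ proj₂) (entries F)
labels≡ []                       = refl
labels≡ ((_ , nothing) ∷ F)      = labels≡ F
labels≡ ((_ , just (k , _)) ∷ F) = cong (k ∷_) (labels≡ F)

countF-entries : ∀ p T → countF p T ≡ countᵇ (uncurry p) (entries T)
countF-entries p []                  = refl
countF-entries p ((d , nothing) ∷ T) = countF-entries p T
countF-entries p ((d , just e) ∷ T)  = cong (λ c → if p d e then suc c else c) (countF-entries p T)

position-⊏-primed : ∀ b′ d′ d → (position b′ d′ ⊏ᵇ position true d) ≡ b′ ∧ lexB (row d′) (col d′) (row d) (col d)
position-⊏-primed true  d′ d = refl
position-⊏-primed false d′ d = refl

position-⊏-unprimed : ∀ b′ d′ d →
  (position b′ d′ ⊏ᵇ position false d) ≡ b′ ∨ (not b′ ∧ lexB (col d′) (row d′) (col d) (row d))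
position-⊏-unprimed true  d′ d = refl
position-⊏-unprimed false d′ d = refl

private
  <ᵇ-≡ᵇ-disjoint : ∀ m n c → ¬ (T (m <ᵇ n) × T ((m ≡ᵇ n) ∧ c))
  <ᵇ-≡ᵇ-disjoint m n c (m<n , eq) =
    <-irrefl (≡ᵇ⇒≡ m n (proj₁ (Equivalence.to T-∧ eq))) (<ᵇ⇒< m n m<n)

  ∧-not-disjoint : ∀ c b c′ d → ¬ (T (c ∧ b) × T (c′ ∧ (not b ∧ d)))
  ∧-not-disjoint true  true  true  _ (_ , ())
  ∧-not-disjoint true  true  false _ (_ , ())
  ∧-not-disjoint true  false _     _ (() , _)
  ∧-not-disjoint false _     _     _ (() , _)

stdNum-rank : ∀ F d e → stdNum F d e ≡ suc (countᵇ (λ (d′ , e′) → key d′ e′ ≺ᵇ key d e) (entries F))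
stdNum-rank F d e = cong suc (begin
  _                                                       ≡⟨ cong₂ _+_ (countF-entries _ F) (sameValueCount (primedB e)) ⟩
  countᵇ smaller E + countᵇ (sameBefore (primedB e)) E     ≡⟨ countᵇ-∨ smaller (sameBefore (primedB e)) E disjoint ⟨
  countᵇ (λ x → smaller x ∨ sameBefore (primedB e) x) E   ∎)
  where
  open ≡-Reasoning
  E = entries F
  smaller : Domino × ℕ → Bool
  smaller (d′ , e′) = val e′ <ᵇ val e
  sameBefore : Bool → Domino × ℕ → Bool
  sameBefore b (d′ , e′) = (val e′ ≡ᵇ val e) ∧ (position (primedB e′) d′ ⊏ᵇ position b d)
  disjoint : ∀ x → ¬ (T (smaller x) × T (sameBefore (primedB e) x))
  disjoint (d′ , e′) = <ᵇ-≡ᵇ-disjoint (val e′) (val e) _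
  sameValueCount : ∀ b →
    (if b then countF (λ d′ e′ → (val e′ ≡ᵇ val e) ∧ primedB e′ ∧ lexB (row d′) (col d′) (row d) (col d)) F
     else (countF (λ d′ e′ → (val e′ ≡ᵇ val e) ∧ primedB e′) F
           + countF (λ d′ e′ → (val e′ ≡ᵇ val e) ∧ not (primedB e′) ∧ lexB (col d′) (row d′) (col d) (row d)) F))
    ≡ countᵇ (sameBefore b) E
  sameValueCount true = trans (countF-entries _ F)
    (countᵇ-cong E λ {(d′ , e′)} _ → cong ((val e′ ≡ᵇ val e) ∧_) (sym (position-⊏-primed (primedB e′) d′ d)))
  sameValueCount false = begin
    _                                               ≡⟨ cong₂ _+_ (countF-entries _ F) (countF-entries _ F) ⟩
    countᵇ primedSame E + countᵇ unprimedBefore E   ≡⟨ countᵇ-∨ primedSame unprimedBefore E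
                                                         (λ (d′ , e′) → ∧-not-disjoint (val e′ ≡ᵇ val e) (primedB e′) (val e′ ≡ᵇ val e) _) ⟨
    countᵇ (λ x → primedSame x ∨ unprimedBefore x) E ≡⟨ countᵇ-cong E (λ {x} _ → merge x) ⟩
    countᵇ (sameBefore false) E                     ∎
    where
    primedSame unprimedBefore : Domino × ℕ → Bool
    primedSame (d′ , e′) = (val e′ ≡ᵇ val e) ∧ primedB e′
    unprimedBefore (d′ , e′) = (val e′ ≡ᵇ val e) ∧ not (primedB e′) ∧ lexB (col d′) (row d′) (col d) (row d)
    merge : ∀ x → (primedSame x ∨ unprimedBefore x) ≡ sameBefore false x
    merge (d′ , e′) = trans (sym (∧-distribˡ-∨ (val e′ ≡ᵇ val e) (primedB e′) _))
      (cong ((val e′ ≡ᵇ val e) ∧_) (sym (position-⊏-unprimed (primedB e′) d′ d)))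

-- Dominoes and standard tableaux

rightCol : Domino → ℕ
rightCol (dom r c hor) = suc c
rightCol (dom r c ver) = c

row≤bottomRow : ∀ d → row d ≤ bottomRow d
row≤bottomRow (dom r c hor) = ≤-refl
row≤bottomRow (dom r c ver) = n≤1+n r

col≤rightCol : ∀ d → col d ≤ rightCol d
col≤rightCol (dom r c hor) = n≤1+n c
col≤rightCol (dom r c ver) = ≤-refl

covers-bounds : ∀ d {a b} → Covers d (a , b) → (row d ≤ a × a ≤ bottomRow d) × (col d ≤ b × b ≤ rightCol d)
covers-bounds (dom r c hor) (inj₁ refl) = (≤-refl , ≤-refl) , (≤-refl , n≤1+n c)
covers-bounds (dom r c ver) (inj₁ refl) = (≤-refl , n≤1+n r) , (≤-refl , ≤-refl)
covers-bounds (dom r c hor) (inj₂ refl) = (≤-refl , ≤-refl) , (n≤1+n c , ≤-refl)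
covers-bounds (dom r c ver) (inj₂ refl) = (n≤1+n r , ≤-refl) , (≤-refl , ≤-refl)

weaklyAbove-row≤1+col : ∀ d → WeaklyAbove d → row d ≤ suc (col d)
weaklyAbove-row≤1+col (dom r c hor) (inj₁ r≤c)   = m≤n⇒m≤1+n r≤c
weaklyAbove-row≤1+col (dom r c hor) (inj₂ r≤c+1) = r≤c+1
weaklyAbove-row≤1+col (dom r c ver) (inj₁ r≤c)   = m≤n⇒m≤1+n r≤c
weaklyAbove-row≤1+col (dom r c ver) (inj₂ r+1≤c) = m≤n⇒m≤1+n (≤-trans (n≤1+n r) r+1≤c)

covers-weaklyAbove : ∀ {d x} → Covers d x → WeaklyAboveCell x → WeaklyAbove d
covers-weaklyAbove (inj₁ refl) above = inj₁ above
covers-weaklyAbove (inj₂ refl) above = inj₂ above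

overlapping-rows⇒shareRow : ∀ d d′ → row d ≤ row d′ → row d′ ≤ bottomRow d → ShareRow d d′
overlapping-rows⇒shareRow (dom r c hor) d′ r≤r′ r′≤r
  rewrite ≤-antisym r≤r′ r′≤r = row d′ , c , col d′ , inj₁ refl , inj₁ refl
overlapping-rows⇒shareRow (dom r c ver) d′ r≤r′ r′≤r+1 with m≤n⇒m<n∨m≡n r′≤r+1
... | inj₁ r′<r+1 rewrite ≤-antisym r≤r′ (≤-pred r′<r+1) = row d′ , c , col d′ , inj₁ refl , inj₁ refl
... | inj₂ refl = suc r , c , col d′ , inj₂ refl , inj₁ refl

shareRow-sym : ∀ {d e} → ShareRow d e → ShareRow e d
shareRow-sym (r , c , c′ , cv , cv′) = r , c′ , c , cv′ , cv

shareCol-sym : ∀ {d e} → ShareCol d e → ShareCol e d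
shareCol-sym (c , r , r′ , cv , cv′) = c , r′ , r , cv′ , cv

shareRow⇒¬lower : ∀ {d e} → ShareRow d e → ¬ StrictlyLower e d
shareRow⇒¬lower {d} {e} (_ , _ , _ , cv , cv′) lower =
  <-irrefl refl (<-≤-trans lower (≤-trans (proj₁ (proj₁ (covers-bounds e cv′))) (proj₂ (proj₁ (covers-bounds d cv)))))

shareCol⇒¬right : ∀ {d e} → ShareCol d e → ¬ rightCol d < col e
shareCol⇒¬right {d} {e} (_ , _ , _ , cv , cv′) right =
  <-irrefl refl (<-≤-trans right (≤-trans (proj₁ (proj₂ (covers-bounds e cv′))) (proj₂ (proj₂ (covers-bounds d cv)))))

part-antitone : ∀ {la} → IsPartition la → ∀ {a a′} → a ≤ a′ → part la a′ ≤ part la a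
part-antitone {[]}         _               _           = z≤n
part-antitone {x ∷ []}     _               {zero} {zero}  _ = ≤-refl
part-antitone {x ∷ []}     _               {zero} {suc _} _ = z≤n
part-antitone {x ∷ []}     _               {suc _} {suc _} _ = z≤n
part-antitone {x ∷ y ∷ ys} _               {zero} {zero}  _ = ≤-refl
part-antitone {x ∷ y ∷ ys} (y≤x , partial) {zero} {suc a′} _ = ≤-trans (part-antitone partial {0} {a′} z≤n) y≤x
part-antitone {x ∷ y ∷ ys} (_ , partial)   {suc a} {suc a′} (s≤s a≤a′) = part-antitone partial a≤a′

inShape-up : ∀ {la} → IsPartition la → ∀ {a a′ b} → a ≤ a′ → InShape la (a′ , b) → InShape la (a , b)
inShape-up partition a≤a′ inS = <-≤-trans inS (part-antitone partition a≤a′)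

module _ {A : Set} where

  same-cell⇒same-item : (F : Filling A) → AllPairs (λ d e → Disjoint d e × LexLess d e) (tilingOf F) →
    ∀ {d m d′ m′ x} → (d , m) ∈ F → (d′ , m′) ∈ F → Covers d x → Covers d′ x → (d , m) ≡ (d′ , m′)
  same-cell⇒same-item (_ ∷ F) _               (here refl) (here refl) _  _  = refl
  same-cell⇒same-item (_ ∷ F) (apart ∷ _) {x = x} (here refl) (there m′) cv cv′ =
    ⊥-elim (proj₁ (All.lookup apart (∈-map⁺ proj₁ m′)) x cv cv′)
  same-cell⇒same-item (_ ∷ F) (apart ∷ _) {x = x} (there m)   (here refl) cv cv′ =
    ⊥-elim (proj₁ (All.lookup apart (∈-map⁺ proj₁ m)) x cv′ cv)
  same-cell⇒same-item (_ ∷ F) (_ ∷ disjoint)     (there m)   (there m′) cv cv′ =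
    same-cell⇒same-item F disjoint m m′ cv cv′

module StandardTableau
  {la : List ℕ} (partition : IsPartition la) {S : Filling MLabel}
  (tiling : Tiling la (tilingOf S)) (labeledOK : All LabeledOK S)
  (labels-inRange : All (InRange (nDominoes S)) (labels S)) (labels-unique : Unique (labels S))
  (rows-increase : RowRel (λ a b → proj₁ a < proj₁ b) S) (cols-increase : ColRel (λ a b → proj₁ a < proj₁ b) S)
  where

  n : ℕ
  n = nDominoes S

  labels-enumerate : Enumerates n (labels S)
  labels-enumerate = record { unique = labels-unique ; inRange = labels-inRange ; length≡n = refl }

  private
    labels-entries : labels S ≡ map (proj₁ ∘ proj₂) (entries S)
    labels-entries = labels≡ S

  label-inRange : ∀ {d k β} → (d , just (k , β)) ∈ S → InRange n k
  label-inRange m = All.lookup labels-inRange (∈-labels m)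

  same-label⇒same-entry : ∀ {d β d′ β′ k} → (d , just (k , β)) ∈ S → (d′ , just (k , β′)) ∈ S → d ≡ d′ × β ≡ β′
  same-label⇒same-entry m m′
    with refl ← unique-map-injective (proj₁ ∘ proj₂) (subst Unique labels-entries labels-unique)
                  (∈-entries⁺ m) (∈-entries⁺ m′) refl = refl , refl

  label-exists : ∀ {k} → InRange n k → ∃[ d ] ∃[ β ] (d , just (k , β)) ∈ S
  label-exists k∈
    with (d , (_ , β)) , m , refl ← ∈-map⁻ (proj₁ ∘ proj₂)
           (subst (_ ∈_) labels-entries (∈-enumeration labels-enumerate k∈))
    = d , β , ∈-entries⁻ m

  same-cell⇒same-entry : ∀ {d m d′ m′ x} → (d , m) ∈ S → (d′ , m′) ∈ S → Covers d x → Covers d′ x → (d , m) ≡ (d′ , m′)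
  same-cell⇒same-entry = same-cell⇒same-item S (proj₁ (proj₂ tiling))

  distinct-labels⇒distinct-dominoes : ∀ {d k β d′ l β′} → (d , just (k , β)) ∈ S → (d′ , just (l , β′)) ∈ S →
                                      k ≢ l → d ≢ d′
  distinct-labels⇒distinct-dominoes m m′ k≢l refl with refl ← same-cell⇒same-entry m m′ (inj₁ refl) (inj₁ refl) = k≢l refl

  entry-inShape : ∀ {d m} → (d , m) ∈ S → InShape la (cell₁ d) × InShape la (cell₂ d)
  entry-inShape m = All.lookup (proj₁ tiling) (∈-map⁺ proj₁ m)

  filled⇒weaklyAbove : ∀ {d a} → (d , just a) ∈ S → WeaklyAbove d
  filled⇒weaklyAbove {d} m with (row d ≤? col d) ⊎-dec (proj₁ (cell₂ d) ≤? proj₂ (cell₂ d))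
  ... | yes above = above
  ... | no  below with () ← proj₂ (All.lookup labeledOK m) below

  weaklyAbove-cell : ∀ {d a} → (d , just a) ∈ S → ∃[ x ] Covers d x × WeaklyAboveCell x × InShape la x
  weaklyAbove-cell {d} m with filled⇒weaklyAbove m
  ... | inj₁ above = cell₁ d , inj₁ refl , above , proj₁ (entry-inShape m)
  ... | inj₂ above = cell₂ d , inj₂ refl , above , proj₂ (entry-inShape m)

  LabelAt : Cell → ℕ → Set
  LabelAt x k = ∃[ d ] ∃[ β ] (d , just (k , β)) ∈ S × Covers d x

  labelAt-unique : ∀ {x k k′} → LabelAt x k → LabelAt x k′ → k ≡ k′
  labelAt-unique (_ , _ , m , cv) (_ , _ , m′ , cv′) with refl ← same-cell⇒same-entry m m′ cv cv′ = refl

  labelAt-exists : ∀ x → InShape la x → WeaklyAboveCell x → ∃[ k ] LabelAt x k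
  labelAt-exists x@(r , c) inS above
    with (d , m) , m∈S , cv ← find (AnyP.map⁻ (proj₂ (proj₂ tiling) r c inS))
    with (k , β) , refl ← proj₁ (All.lookup labeledOK m∈S) (covers-weaklyAbove cv above)
    = k , d , β , m∈S , cv

  private
    label-step : ∀ {x y k k′} →
      (∀ {d a e b} → (d , just a) ∈ S → (e , just b) ∈ S → d ≢ e → Covers d x → Covers e y → proj₁ a < proj₁ b) →
      LabelAt x k → LabelAt y k′ → k ≤ k′
    label-step {k = k} {k′} increase (_ , _ , m , cv) (_ , _ , m′ , cv′) with k ≟ k′
    ... | yes refl = ≤-refl
    ... | no  k≢k′ = <⇒≤ (increase m m′ (distinct-labels⇒distinct-dominoes m m′ k≢k′) cv cv′)

  label-mono-row : ∀ {r c c′ k k′} → r ≤ c → c ≤ c′ → InShape la (r , c′) →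
                   LabelAt (r , c) k → LabelAt (r , c′) k′ → k ≤ k′
  label-mono-row {c′ = zero} _ z≤n _ at at′ = ≤-reflexive (labelAt-unique at at′)
  label-mono-row {r} {c} {suc c′} r≤c c≤c′+1 inS at at′ with m≤n⇒m<n∨m≡n c≤c′+1
  ... | inj₂ refl   = ≤-reflexive (labelAt-unique at at′)
  ... | inj₁ c<c′+1 with inS′ ← <-trans (n<1+n c′) inS
                     with k″ , at″ ← labelAt-exists (r , c′) inS′ (≤-trans r≤c (≤-pred c<c′+1))
    = ≤-trans (label-mono-row r≤c (≤-pred c<c′+1) inS′ at at″)
              (label-step (λ m m′ d≢e → rows-increase m m′ d≢e r c′) at″ at′)

  label-mono-col : ∀ {r r′ c k k′} → r ≤ r′ → r′ ≤ c → InShape la (r′ , c) →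
                   LabelAt (r , c) k → LabelAt (r′ , c) k′ → k ≤ k′
  label-mono-col {r′ = zero} z≤n _ _ at at′ = ≤-reflexive (labelAt-unique at at′)
  label-mono-col {r} {suc r′} {c} r≤r′+1 r′+1≤c inS at at′ with m≤n⇒m<n∨m≡n r≤r′+1
  ... | inj₂ refl   = ≤-reflexive (labelAt-unique at at′)
  ... | inj₁ r<r′+1 with r′≤c ← ≤-trans (n≤1+n r′) r′+1≤c
                     with inS′ ← inShape-up partition (n≤1+n r′) inS
                     with k″ , at″ ← labelAt-exists (r′ , c) inS′ r′≤c
    = ≤-trans (label-mono-col (≤-pred r<r′+1) r′≤c inS′ at at″)
              (label-step (λ m m′ d≢e → cols-increase m m′ d≢e r′ c) at″ at′)

  label-mono-cells : ∀ {a b a′ b′ k k′} → a ≤ b → a ≤ a′ → b ≤ b′ → a′ ≤ b′ → InShape la (a′ , b′) →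
                     LabelAt (a , b) k → LabelAt (a′ , b′) k′ → k ≤ k′
  label-mono-cells {a} {b} {a′} {b′} a≤b a≤a′ b≤b′ a′≤b′ inS at at′
    with k″ , at″ ← labelAt-exists (a , b′) (inShape-up partition a≤a′ inS) (≤-trans a≤b b≤b′)
    = ≤-trans (label-mono-row a≤b b≤b′ (inShape-up partition a≤a′ inS) at at″)
              (label-mono-col a≤a′ a′≤b′ inS at″ at′)

  label-mono : ∀ {d k β a′ b′ k′} → (d , just (k , β)) ∈ S → row d ≤ a′ → col d ≤ b′ → a′ ≤ b′ →
               InShape la (a′ , b′) → LabelAt (a′ , b′) k′ → k ≤ k′
  label-mono {d} {k} {β} {a′} {b′} {k′} m r≤a′ c≤b′ a′≤b′ inS at′ with row d ≤? col d
  ... | yes r≤c = label-mono-cells r≤c r≤a′ c≤b′ a′≤b′ inS (d , β , m , inj₁ refl) at′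
  ... | no  r≰c = fromEastCell d m (filled⇒weaklyAbove m) r≤a′ r≰c
    where
    -- A filled domino whose north-west cell is below the diagonal is horizontal with its east cell on it.
    fromEastCell : ∀ d → (d , just (k , β)) ∈ S → WeaklyAbove d → row d ≤ a′ → ¬ row d ≤ col d → k ≤ k′
    fromEastCell (dom r c hor) m (inj₁ r≤c)   _    r≰c = ⊥-elim (r≰c r≤c)
    fromEastCell (dom r c ver) m (inj₁ r≤c)   _    r≰c = ⊥-elim (r≰c r≤c)
    fromEastCell (dom r c ver) m (inj₂ r+1≤c) _    r≰c = ⊥-elim (r≰c (≤-trans (n≤1+n r) r+1≤c))
    fromEastCell (dom r c hor) m (inj₂ r≤c+1) r≤a′ r≰c =
      label-mono-cells r≤c+1 r≤a′ (≤-trans (≰⇒> r≰c) (≤-trans r≤a′ a′≤b′)) a′≤b′ inS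
        (dom r c hor , β , m , inj₂ refl) at′

  label1-covers-origin : ∀ {d β} → (d , just (1 , β)) ∈ S → Covers d (0 , 0)
  label1-covers-origin {d} {β} m
    with (a , b) , cv , a≤b , inS ← weaklyAbove-cell m
    with k₀ , d₀ , β₀ , m₀ , cv₀ ← labelAt-exists (0 , 0) (inShape-up partition z≤n (≤-<-trans z≤n inS)) z≤n
    with (r₀≤0 , _) , (c₀≤0 , _) ← covers-bounds d₀ cv₀
    with refl ← ≤-antisym (label-mono m₀ (≤-trans r₀≤0 z≤n) (≤-trans c₀≤0 z≤n) a≤b inS (d , β , m , cv))
                          (proj₁ (label-inRange m₀))
    with refl , _ ← same-label⇒same-entry m₀ m
    = cv₀

  consecutive-lower⇒shareCol : ∀ {d j β d′ β′} → (d , just (j , β)) ∈ S → (d′ , just (suc j , β′)) ∈ S →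
                               col d ≤ col d′ → StrictlyLower d′ d → ShareCol d d′
  consecutive-lower⇒shareCol {d} {d′ = d′} m m′ c≤c′ lower with m≤n⇒m<n∨m≡n c≤c′
  ... | inj₂ c≡c′ = col d , row d , row d′ , inj₁ refl , inj₁ (cong (row d′ ,_) (sym c≡c′))
  ... | inj₁ c<c′
    with (a , b) , cv′ , a≤b , inS ← weaklyAbove-cell m′
    with (r′≤a , _) , (c′≤b , _) ← covers-bounds d′ cv′
    with r≤a ← ≤-trans (row≤bottomRow d) (≤-trans (<⇒≤ lower) r′≤a)
    with r≤b ← ≤-trans (weaklyAbove-row≤1+col d (filled⇒weaklyAbove m)) (≤-trans c<c′ c′≤b)
    with inS′ ← inShape-up partition r≤a inS
    with k , e , γ , mₑ , cvₑ ← labelAt-exists (row d , b) inS′ r≤b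
    with (rₑ≤r , _) , (cₑ≤b , _) ← covers-bounds e cvₑ
    with j≤k ← label-mono m ≤-refl (≤-trans (<⇒≤ c<c′) c′≤b) r≤b inS′ (e , γ , mₑ , cvₑ)
    with k≤j+1 ← label-mono mₑ (≤-trans rₑ≤r r≤a) cₑ≤b a≤b inS (d′ , _ , m′ , cv′)
    with m≤n⇒m<n∨m≡n k≤j+1
  ... | inj₁ k<j+1 with refl ← ≤-antisym (≤-pred k<j+1) j≤k with refl , _ ← same-label⇒same-entry mₑ m
    = b , row d , a , cvₑ , cv′
  ... | inj₂ refl with refl , _ ← same-label⇒same-entry mₑ m′
    = ⊥-elim (<-irrefl refl (≤-<-trans rₑ≤r (≤-<-trans (row≤bottomRow d) lower)))

  consecutive-notLower⇒right : ∀ {d j β d′ β′} → (d , just (j , β)) ∈ S → (d′ , just (suc j , β′)) ∈ S →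
                               ¬ StrictlyLower d′ d → rightCol d < col d′
  consecutive-notLower⇒right {d} {j} {β} {d′} {β′} m m′ notLower with suc (rightCol d) ≤? col d′
  ... | yes right = right
  ... | no  ¬right = ⊥-elim (<-irrefl refl (reach d m (filled⇒weaklyAbove m) (≮⇒≥ notLower) (≮⇒≥ ¬right)))
    where
    -- Here d is a vertical domino on the diagonal; a filled domino starting in the row of its
    -- lower cell and not to the right of it would have to overlap it.
    onDiagonal : ∀ {r c} e → (e , just (suc j , β′)) ∈ S → (dom r c ver , just (j , β)) ∈ S →
                 ¬ suc r ≤ c → row e ≡ suc r → col e ≤ c → ⊥
    onDiagonal (dom _ c′ hor) mₑ m r+1≰c refl c′≤c with filled⇒weaklyAbove mₑ
    ... | inj₁ r+1≤c′      = r+1≰c (≤-trans r+1≤c′ c′≤c)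
    ... | inj₂ (s≤s r≤c′) with refl ← ≤-antisym c′≤c (≤-trans (≤-pred (≰⇒> r+1≰c)) r≤c′)
                          with () ← same-cell⇒same-entry mₑ m (inj₁ refl) (inj₂ refl)
    onDiagonal (dom _ c′ ver) mₑ m r+1≰c refl c′≤c with filled⇒weaklyAbove mₑ
    ... | inj₁ r+1≤c′  = r+1≰c (≤-trans r+1≤c′ c′≤c)
    ... | inj₂ r+2≤c′  = r+1≰c (≤-trans (n≤1+n _) (≤-trans r+2≤c′ c′≤c))
    reach : ∀ d → (d , just (j , β)) ∈ S → WeaklyAbove d → row d′ ≤ bottomRow d → col d′ ≤ rightCol d → suc j ≤ j
    reach (dom r c hor) m above r′≤r c′≤c+1 =
      label-mono m′ r′≤r c′≤c+1 (weaklyAbove-row≤1+col (dom r c hor) above) (proj₂ (entry-inShape m)) (dom r c hor , β , m , inj₂ refl)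
    reach (dom r c ver) m above r′≤r+1 c′≤c with m≤n⇒m<n∨m≡n r′≤r+1 | suc r ≤? c
    ... | inj₁ r′<r+1 | _ =
      label-mono m′ (≤-pred r′<r+1) c′≤c (r≤c above) (proj₁ (entry-inShape m)) (dom r c ver , β , m , inj₁ refl)
      where
      r≤c : WeaklyAbove (dom r c ver) → r ≤ c
      r≤c (inj₁ r≤c)   = r≤c
      r≤c (inj₂ r+1≤c) = ≤-trans (n≤1+n r) r+1≤c
    ... | inj₂ r′≡r+1 | yes r+1≤c =
      label-mono m′ (≤-reflexive r′≡r+1) c′≤c r+1≤c (proj₂ (entry-inShape m)) (dom r c ver , β , m , inj₂ refl)
    ... | inj₂ r′≡r+1 | no r+1≰c = ⊥-elim (onDiagonal d′ m′ m r+1≰c r′≡r+1 c′≤c)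

  descent0-inv : ∀ {d β} → (d , just (1 , β)) ∈ S → Des S 0 → β ≡ true ⊎ ori d ≡ ver
  descent0-inv m (inj₁ (_ , mₑ))         with refl , β≡true ← same-label⇒same-entry m mₑ = inj₁ β≡true
  descent0-inv m (inj₂ (_ , _ , mₑ , v)) with refl , _      ← same-label⇒same-entry m mₑ = inj₂ v

  module _ {i d β d′ β′} (m : (d , just (i , β)) ∈ S) (m′ : (d′ , just (suc i , β′)) ∈ S) where

    UDes⇒lower : UDes S i → StrictlyLower d′ d
    UDes⇒lower (_ , _ , _ , _ , mₑ , mₑ′ , lower)
      with refl , _ ← same-label⇒same-entry m mₑ | refl , _ ← same-label⇒same-entry m′ mₑ′ = lower

    lower⇒UDes : StrictlyLower d′ d → UDes S i
    lower⇒UDes lower = d , β , d′ , β′ , m , m′ , lower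

  descent-inv : ∀ {j d β d′ β′} → (d , just (suc j , β)) ∈ S → (d′ , just (suc (suc j) , β′)) ∈ S →
                Des S (suc j) → (β ≡ false × StrictlyLower d′ d) ⊎ (β′ ≡ true × ¬ StrictlyLower d′ d)
  descent-inv m m′ (inj₁ ((_ , mₑ) , udes)) with refl , β≡false ← same-label⇒same-entry m mₑ =
    inj₁ (β≡false , UDes⇒lower m m′ udes)
  descent-inv m m′ (inj₂ ((_ , mₑ) , ¬udes)) with refl , β′≡true ← same-label⇒same-entry m′ mₑ =
    inj₂ (β′≡true , ¬udes ∘ lower⇒UDes m m′)

  unprimed-step : ∀ {i d d′ β′} → 1 ≤ i → ¬ Des S i →
                  (d , just (i , false)) ∈ S → (d′ , just (suc i , β′)) ∈ S →
                  β′ ≡ false × rightCol d < col d′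
  unprimed-step {suc j} {d} {d′} {β′} _ ¬des m m′ = primed? β′ refl , consecutive-notLower⇒right m m′ notLower
    where
    notLower : ¬ StrictlyLower d′ d
    notLower lower = ¬des (inj₁ ((_ , m) , lower⇒UDes m m′ lower))
    primed? : ∀ b → β′ ≡ b → β′ ≡ false
    primed? false eq   = eq
    primed? true  refl = ⊥-elim (¬des (inj₂ ((_ , m′) , notLower ∘ UDes⇒lower m m′)))

  primed-step : ∀ {i d β d′} → 1 ≤ i → ¬ Des S i →
                (d , just (i , β)) ∈ S → (d′ , just (suc i , true)) ∈ S →
                β ≡ true × StrictlyLower d′ d
  primed-step {suc j} {d} {β} {d′} _ ¬des m m′ with suc (bottomRow d) ≤? row d′
  ... | no  notLower = ⊥-elim (¬des (inj₂ ((_ , m′) , notLower ∘ UDes⇒lower m m′)))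
  ... | yes lower    = unprimed? β refl , lower
    where
    unprimed? : ∀ b → β ≡ b → β ≡ true
    unprimed? true  eq   = eq
    unprimed? false refl = ⊥-elim (¬des (inj₁ ((_ , m) , lower⇒UDes m m′ lower)))

  NoDescentIn : ℕ → ℕ → Set
  NoDescentIn k l = ∀ j → k ≤ j → j < l → ¬ Des S j

  private
    run-entry : ∀ {k l d′ β′} → 1 ≤ k → k <′ l → (d′ , just (suc l , β′)) ∈ S → ∃[ d ] ∃[ β ] (d , just (l , β)) ∈ S
    run-entry 1≤k k<l m′ = label-exists (≤-trans 1≤k (<⇒≤ (<′⇒< k<l)) , ≤-trans (n≤1+n _) (proj₂ (label-inRange m′)))

  unprimed-run : ∀ {k l d d′ β′} → 1 ≤ k → k <′ l → NoDescentIn k l →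
                 (d , just (k , false)) ∈ S → (d′ , just (l , β′)) ∈ S → β′ ≡ false × rightCol d < col d′
  unprimed-run 1≤k ≤′-refl noDes m m′ = unprimed-step 1≤k (noDes _ ≤-refl ≤-refl) m m′
  unprimed-run 1≤k (≤′-step k<l) noDes m m′
    with d″ , β″ , m″ ← run-entry 1≤k k<l m′
    with refl , right ← unprimed-run 1≤k k<l (λ j k≤j j<l → noDes j k≤j (m<n⇒m<1+n j<l)) m m″
    with β′≡false , right′ ← unprimed-step (≤-trans 1≤k (<⇒≤ (<′⇒< k<l))) (noDes _ (<⇒≤ (<′⇒< k<l)) ≤-refl) m″ m′
    = β′≡false , <-trans (<-≤-trans right (col≤rightCol d″)) right′

  primed-run : ∀ {k l d β d′} → 1 ≤ k → k <′ l → NoDescentIn k l →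
               (d , just (k , β)) ∈ S → (d′ , just (l , true)) ∈ S → β ≡ true × StrictlyLower d′ d
  primed-run 1≤k ≤′-refl noDes m m′ = primed-step 1≤k (noDes _ ≤-refl ≤-refl) m m′
  primed-run 1≤k (≤′-step k<l) noDes m m′
    with d″ , β″ , m″ ← run-entry 1≤k k<l m′
    with refl , lower′ ← primed-step (≤-trans 1≤k (<⇒≤ (<′⇒< k<l))) (noDes _ (<⇒≤ (<′⇒< k<l)) ≤-refl) m″ m′
    with β≡true , lower ← primed-run 1≤k k<l (λ j k≤j j<l → noDes j k≤j (m<n⇒m<1+n j<l)) m m″
    = β≡true , <-trans (<-≤-trans lower (row≤bottomRow d″)) lower′

_‼_ : List ℕ → ℕ → ℕ
[]       ‼ _     = 0
(x ∷ xs) ‼ zero  = x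
(x ∷ xs) ‼ suc i = xs ‼ i

-- i_k for is = (i₁, …, iₙ), with i₀ = 0 (and 0 beyond n)
valueOf : List ℕ → ℕ → ℕ
valueOf is k = (0 ∷ is) ‼ k

FBStep : (ℕ → Set) → ℕ → List ℕ → ℕ → Set
FBStep D m xs i = xs ‼ i ≤ xs ‼ suc i × (D (m + i) → xs ‼ i < xs ‼ suc i)

FBSeq⇔ : ∀ D m p xs → FBSeq D m p xs ⇔ (∀ i → i < length xs → FBStep D m (p ∷ xs) i)
FBSeq⇔ D m p xs = mk⇔ (to m p xs) (from m p xs)
  where
  to : ∀ m p xs → FBSeq D m p xs → ∀ i → i < length xs → FBStep D m (p ∷ xs) i
  to m p (x ∷ xs) (p≤x , strict , rest) zero    _         = p≤x , strict ∘ subst D (+-identityʳ m)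
  to m p (x ∷ xs) (p≤x , strict , rest) (suc i) (s≤s i<) =
    let x≤ , strict′ = to (suc m) x xs rest i i< in x≤ , strict′ ∘ subst D (+-suc m i)
  from : ∀ m p xs → (∀ i → i < length xs → FBStep D m (p ∷ xs) i) → FBSeq D m p xs
  from m p []       _     = _
  from m p (x ∷ xs) steps =
    proj₁ (steps 0 z<s) , proj₂ (steps 0 z<s) ∘ subst D (sym (+-identityʳ m)) ,
    from (suc m) x xs (λ i i< → let x≤ , strict = steps (suc i) (s<s i<) in x≤ , strict ∘ subst D (sym (+-suc m i)))

module FBSequence {D : ℕ → Set} {n : ℕ} {is : List ℕ} (len : length is ≡ n) (fb : FBSeq D 0 0 is) where

  step : ∀ i → i < n → valueOf is i ≤ valueOf is (suc i) × (D i → valueOf is i < valueOf is (suc i))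
  step i i<n = Equivalence.to (FBSeq⇔ D 0 0 is) fb i (subst (i <_) (sym len) i<n)

  valueOf-mono : ∀ {a b} → a ≤ b → b ≤ n → valueOf is a ≤ valueOf is b
  valueOf-mono {b = zero} z≤n _ = ≤-refl
  valueOf-mono {a} {suc b} a≤b+1 b+1≤n with m≤n⇒m<n∨m≡n a≤b+1
  ... | inj₂ refl  = ≤-refl
  ... | inj₁ a<b+1 = ≤-trans (valueOf-mono (≤-pred a<b+1) (<⇒≤ b+1≤n)) (proj₁ (step b b+1≤n))

  equal⇒noDescent : ∀ {k l} → l ≤ n → valueOf is k ≡ valueOf is l → ∀ j → k ≤ j → j < l → ¬ D j
  equal⇒noDescent {k} {l} l≤n eq j k≤j j<l dj = <-irrefl eq (begin-strict
    valueOf is k       ≤⟨ valueOf-mono k≤j (≤-trans (<⇒≤ j<l) l≤n) ⟩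
    valueOf is j       <⟨ proj₂ (step j (<-≤-trans j<l l≤n)) dj ⟩
    valueOf is (suc j) ≤⟨ valueOf-mono j<l l≤n ⟩
    valueOf is l       ∎)
    where open ≤-Reasoning

valueOf-applyUpTo : ∀ (f : ℕ → ℕ) n {i} → i < n → valueOf (applyUpTo f n) (suc i) ≡ f i
valueOf-applyUpTo f (suc n) {zero}  _        = refl
valueOf-applyUpTo f (suc n) {suc i} (s≤s i<n) = valueOf-applyUpTo (f ∘ suc) n i<n

applyUpTo-valueOf : ∀ is → applyUpTo (valueOf is ∘ suc) (length is) ≡ is
applyUpTo-valueOf []       = refl
applyUpTo-valueOf (x ∷ is) = cong (x ∷_) (applyUpTo-valueOf is)

applyUpTo-cong : ∀ {f g : ℕ → ℕ} n → (∀ {i} → i < n → f i ≡ g i) → applyUpTo f n ≡ applyUpTo g n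
applyUpTo-cong zero    _   = refl
applyUpTo-cong (suc n) f≡g = cong₂ _∷_ (f≡g z<s) (applyUpTo-cong n (f≡g ∘ s<s))

fillCell : List ℕ → Domino × Maybe MLabel → Domino × Maybe ℕ
fillCell is (d , nothing)      = d , nothing
fillCell is (d , just (k , β)) = d , just (entry (valueOf is k) β)

fill : List ℕ → Filling MLabel → Filling ℕ
fill is = map (fillCell is)

stdCell : Filling ℕ → Domino × Maybe ℕ → Domino × Maybe MLabel
stdCell F (d , nothing) = d , nothing
stdCell F (d , just e)  = d , just (stdNum F d e , primedB e)

std≡map-stdCell : ∀ F → std F ≡ map (stdCell F) F
std≡map-stdCell F = map-cong (λ { (d , nothing) → refl ; (d , just e) → refl }) F

labelValue : Filling MLabel → Filling ℕ → ℕ → ℕ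
labelValue ((_ , just (k′ , _)) ∷ S) ((_ , just e) ∷ F) k = if k′ ≡ᵇ k then val e else labelValue S F k
labelValue (_ ∷ S)                   (_ ∷ F)            k = labelValue S F k
labelValue _                         _                  _ = 0

readOff : Filling MLabel → Filling ℕ → List ℕ
readOff S F = applyUpTo (labelValue S F ∘ suc) (nDominoes S)

private
  pick-own-label : ∀ k {A : Set} (a b : A) → (if k ≡ᵇ k then a else b) ≡ a
  pick-own-label k a b with k ≡ᵇ k | ≡ᵇ-reflects-≡ k k
  ... | true  | _       = refl
  ... | false | ofⁿ k≢k = ⊥-elim (k≢k refl)

  skip-other-label : ∀ {k′ k} {S′ : List ℕ} → All (k′ ≢_) S′ → k ∈ S′ → ∀ {A : Set} (a b : A) → (if k′ ≡ᵇ k then a else b) ≡ b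
  skip-other-label {k′} {k} k′∉ k∈ a b with k′ ≡ᵇ k | ≡ᵇ-reflects-≡ k′ k
  ... | false | _         = refl
  ... | true  | ofʸ refl  = ⊥-elim (All.lookup k′∉ k∈ refl)

labelValue-fill : ∀ is S → Unique (labels S) → ∀ {d k β} → (d , just (k , β)) ∈ S → labelValue S (fill is S) k ≡ valueOf is k
labelValue-fill is ((_ , just (k , β)) ∷ S) _ (here refl) =
  trans (pick-own-label k _ _) (val-entry (valueOf is k) β)
labelValue-fill is ((_ , nothing) ∷ S) u (there m) = labelValue-fill is S u m
labelValue-fill is ((_ , just (k′ , β′)) ∷ S) (k′∉ ∷ u) (there m) =
  trans (skip-other-label k′∉ (∈-labels m) _ _) (labelValue-fill is S u m)

labelValue-std : ∀ G F → Unique (labels (map (stdCell G) F)) →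
                 ∀ {d e} → (d , just e) ∈ F → labelValue (map (stdCell G) F) F (stdNum G d e) ≡ val e
labelValue-std G ((d , just e) ∷ F)  _          (here refl) = pick-own-label (stdNum G d e) _ _
labelValue-std G ((_ , nothing) ∷ F) u          (there m)   = labelValue-std G F u m
labelValue-std G ((_ , just _) ∷ F)  (k′∉ ∷ u) (there m)   =
  trans (skip-other-label k′∉ (∈-labels (∈-map⁺ (stdCell G) m)) _ _) (labelValue-std G F u m)

map≡⇒fixed : ∀ {A : Set} (f : A → A) {xs : List A} → map f xs ≡ xs → ∀ {x} → x ∈ xs → f x ≡ x
map≡⇒fixed f {_ ∷ xs} eq (here refl) = ∷-injectiveˡ eq
map≡⇒fixed f {_ ∷ xs} eq (there x∈)  = map≡⇒fixed f (∷-injectiveʳ eq) x∈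

∈-fill⁺ : ∀ is {S d k β} → (d , just (k , β)) ∈ S → (d , just (entry (valueOf is k) β)) ∈ fill is S
∈-fill⁺ is = ∈-map⁺ (fillCell is)

∈-fill⁻ : ∀ is {S d e} → (d , just e) ∈ fill is S → ∃[ k ] ∃[ β ] (d , just (k , β)) ∈ S × e ≡ entry (valueOf is k) β
∈-fill⁻ is m with ∈-map⁻ (fillCell is) m
... | (_ , just (k , β)) , m′ , refl = k , β , m′ , refl

tilingOf-fill : ∀ is S → tilingOf (fill is S) ≡ tilingOf S
tilingOf-fill is S = trans (sym (map-∘ S)) (map-cong (λ { (_ , nothing) → refl ; (_ , just _) → refl }) S)

labeledOK-fill : ∀ is {S} → All LabeledOK S → All LabeledOK (fill is S)
labeledOK-fill is ok = AllP.map⁺ (All.map fillOK ok)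
  where
  fillOK : ∀ {x} → LabeledOK x → LabeledOK (fillCell is x)
  fillOK {d , nothing}      (above⇒just , _) = (λ above → case above⇒just above of λ { (_ , ()) }) , λ _ → refl
  fillOK {d , just (k , β)} (_ , below⇒nothing) = (λ _ → _ , refl) , λ below → case below⇒nothing below of λ ()

entries-fill : ∀ is S → entries (fill is S) ≡ map (λ (d , (k , β)) → d , entry (valueOf is k) β) (entries S)
entries-fill is []                      = refl
entries-fill is ((_ , nothing) ∷ S)     = entries-fill is S
entries-fill is ((d , just (k , β)) ∷ S) = cong ((d , entry (valueOf is k) β) ∷_) (entries-fill is S)

wt-entries : ∀ F v → wt F v ≡ countᵇ (λ (d , e) → val e ≡ᵇ v) (entries F)
wt-entries []                  v = refl
wt-entries ((_ , nothing) ∷ F) v = wt-entries F v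
wt-entries ((_ , just e) ∷ F)  v = cong (λ c → if val e ≡ᵇ v then suc c else c) (wt-entries F v)

mult≡countᵇ : ∀ is v → mult is v ≡ countᵇ (_≡ᵇ v) is
mult≡countᵇ []       v = refl
mult≡countᵇ (x ∷ is) v = cong (λ c → if x ≡ᵇ v then suc c else c) (mult≡countᵇ is v)

-- Standardization of a filled tableau

module Standardization
  {la : List ℕ} (partition : IsPartition la) {S : Filling MLabel}
  (tiling : Tiling la (tilingOf S)) (shifted : ShiftedTiling (tilingOf S)) (labeledOK : All LabeledOK S)
  (labels-inRange : All (InRange (nDominoes S)) (labels S)) (labels-unique : Unique (labels S))
  (rows-increase : RowRel (λ a b → proj₁ a < proj₁ b) S) (cols-increase : ColRel (λ a b → proj₁ a < proj₁ b) S)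
  where

  open StandardTableau partition tiling labeledOK labels-inRange labels-unique rows-increase cols-increase

  readOff-fill : ∀ is → length is ≡ n → readOff S (fill is S) ≡ is
  readOff-fill is len = begin
    applyUpTo (labelValue S (fill is S) ∘ suc) n ≡⟨ applyUpTo-cong n labelValue≡ ⟩
    applyUpTo (valueOf is ∘ suc) n               ≡⟨ cong (applyUpTo (valueOf is ∘ suc)) len ⟨
    applyUpTo (valueOf is ∘ suc) (length is)     ≡⟨ applyUpTo-valueOf is ⟩
    is                                           ∎
    where
    open ≡-Reasoning
    labelValue≡ : ∀ {i} → i < n → labelValue S (fill is S) (suc i) ≡ valueOf is (suc i)
    labelValue≡ i<n with _ , _ , m ← label-exists (s≤s z≤n , i<n) = labelValue-fill is S labels-unique m

  fill-readOff : ∀ F → std F ≡ S → F ≡ fill (readOff S F) S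
  fill-readOff F std≡S = begin
    F                                          ≡⟨ map-id-local (All.tabulate restored) ⟨
    map (fillCell is ∘ stdCell F) F            ≡⟨ map-∘ F ⟩
    map (fillCell is) (map (stdCell F) F)      ≡⟨ cong (fill is) S≡ ⟨
    fill is S                                  ∎
    where
    open ≡-Reasoning
    is = readOff S F
    S≡ : S ≡ map (stdCell F) F
    S≡ = trans (sym std≡S) (std≡map-stdCell F)
    restored : ∀ {x} → x ∈ F → fillCell is (stdCell F x) ≡ x
    restored {d , nothing} _ = refl
    restored {d , just e}  m = cong (λ v → d , just v) (trans (cong (λ v → entry v (primedB e)) value≡) (entry-val e))
      where
      m′ : (d , just (stdNum F d e , primedB e)) ∈ S
      m′ = subst (_ ∈_) (sym S≡) (∈-map⁺ (stdCell F) m)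
      value≡ : valueOf is (stdNum F d e) ≡ val e
      value≡ = begin
        valueOf is (stdNum F d e)                              ≡⟨ valueOf-applyUpTo _ n (proj₂ (label-inRange m′)) ⟩
        labelValue S F (stdNum F d e)                          ≡⟨ cong (λ S′ → labelValue S′ F (stdNum F d e)) S≡ ⟩
        labelValue (map (stdCell F) F) F (stdNum F d e)        ≡⟨ labelValue-std F F (subst (Unique ∘ labels) S≡ labels-unique) m ⟩
        val e                                                  ∎

  module Filled (is : List ℕ) where

    code : ℕ → Bool → ℕ
    code k β = entry (valueOf is k) β

    keyAt : Domino × MLabel → Key
    keyAt (d , (k , β)) = key d (code k β)

    _◁_ : Domino × MLabel → Domino × MLabel → Bool
    x ◁ y = keyAt x ≺ᵇ keyAt y

    private
      module K = IsStrictTotalᵇ ≺ᵇ-isStrictTotal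

    open Ranking _◁_ (K.irreflexive ∘ keyAt) (λ x y z → K.transitive (keyAt x) (keyAt y) (keyAt z))
                 (proj₁ ∘ proj₂) (entries S) (subst (Enumerates n) (labels≡ S) labels-enumerate)

    stdNum-fill : ∀ d k β → stdNum (fill is S) d (code k β) ≡ rank (d , (k , β))
    stdNum-fill d k β = trans (stdNum-rank (fill is S) d (code k β)) (cong suc (begin
      countᵇ _ (entries (fill is S))   ≡⟨ cong (countᵇ _) (entries-fill is S) ⟩
      countᵇ _ (map _ (entries S))     ≡⟨ countᵇ-map _ _ (entries S) ⟩
      countᵇ (_◁ (d , (k , β))) (entries S) ∎))
      where open ≡-Reasoning

    Correct : Set
    Correct = ∀ {d k β} → (d , just (k , β)) ∈ S → stdNum (fill is S) d (code k β) ≡ k × primedB (code k β) ≡ β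

    std-fill⇒correct : std (fill is S) ≡ S → Correct
    std-fill⇒correct std≡S m = cong (proj₁ ∘ label) fixed , cong (proj₂ ∘ label) fixed
      where
      label : Domino × Maybe MLabel → MLabel
      label (_ , just a) = a
      label (_ , nothing) = 0 , false
      fixed = map≡⇒fixed (stdCell (fill is S) ∘ fillCell is)
                (trans (map-∘ S) (trans (sym (std≡map-stdCell (fill is S))) std≡S)) m

    correct⇒std-fill : Correct → std (fill is S) ≡ S
    correct⇒std-fill correct = begin
      std (fill is S)                                  ≡⟨ std≡map-stdCell (fill is S) ⟩
      map (stdCell (fill is S)) (map (fillCell is) S)  ≡⟨ map-∘ S ⟨
      map (stdCell (fill is S) ∘ fillCell is) S        ≡⟨ map-id-local (All.tabulate fixed) ⟩
      S                                                ∎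
      where
      open ≡-Reasoning
      fixed : ∀ {x} → x ∈ S → stdCell (fill is S) (fillCell is x) ≡ x
      fixed {_ , nothing}     _ = refl
      fixed {d , just (k , β)} m with correct m
      ... | rank≡k , primed≡β rewrite rank≡k | primed≡β = refl

    Ordered : Set
    Ordered = ∀ {d k β d′ l β′} → (d , just (k , β)) ∈ S → (d′ , just (l , β′)) ∈ S → k < l →
              T ((d , (k , β)) ◁ (d′ , (l , β′)))

    correct⇒ordered : Correct → Ordered
    correct⇒ordered correct m m′ = rank≡label⇒ordered rank≡label incomparable (∈-entries⁺ m) (∈-entries⁺ m′)
      where
      rank≡label : ∀ {x} → x ∈ entries S → rank x ≡ proj₁ (proj₂ x)
      rank≡label {d , (k , β)} x∈ = trans (sym (stdNum-fill d k β)) (proj₁ (correct (∈-entries⁻ x∈)))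
      incomparable : ∀ {x y} → x ∈ entries S → y ∈ entries S → ¬ T (x ◁ y) → ¬ T (y ◁ x) →
                     proj₁ (proj₂ x) ≡ proj₁ (proj₂ y)
      incomparable {d , (k , β)} {d′ , (l , β′)} x∈ y∈ x⋪y y⋪x
        with refl ← same-cell⇒same-entry (∈-entries⁻ x∈) (∈-entries⁻ y∈) (inj₁ refl)
                      (inj₁ (sym (key≡⇒cell₁≡ d (code k β) d′ (code l β′) (K.incomparable⇒≡ _ _ x⋪y y⋪x))))
        = refl

    ordered⇒rank : Ordered → ∀ {d k β} → (d , just (k , β)) ∈ S → stdNum (fill is S) d (code k β) ≡ k
    ordered⇒rank ordered {d} {k} {β} m = trans (stdNum-fill d k β)
      (ordered⇒rank≡label (λ {(_ , _ , _)} {(_ , _ , _)} x∈ y∈ → ordered (∈-entries⁻ x∈) (∈-entries⁻ y∈)) (∈-entries⁺ m))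

    module Forward (tableau : SSShDT la (fill is S)) (correct : Correct) where

      private
        unprimed-columns = proj₁ (proj₂ (proj₂ (proj₂ (proj₂ tableau))))
        primed-rows      = proj₁ (proj₂ (proj₂ (proj₂ tableau)))
        zero-horizontal  = proj₂ (proj₂ (proj₂ (proj₂ (proj₂ tableau))))

        primed-correct : ∀ {d k β} → (d , just (k , β)) ∈ S → primedB (code k β) ≡ β
        primed-correct m = proj₂ (correct m)

        keys-ordered : ∀ {d k β d′ l β′} → (d , just (k , β)) ∈ S → (d′ , just (l , β′)) ∈ S → k < l →
                       T (keyOf d (valueOf is k) β ≺ᵇ keyOf d′ (valueOf is l) β′)
        keys-ordered {d} {k} {β} {d′} {l} {β′} m m′ k<l =
          subst₂ (λ a b → T (a ≺ᵇ b)) (key-entry d (valueOf is k) β (primed-correct m)) (key-entry d′ (valueOf is l) β′ (primed-correct m′))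
            (correct⇒ordered correct m m′ k<l)

        weakly-increasing : ∀ {d j β d′ β′} → (d , just (j , β)) ∈ S → (d′ , just (suc j , β′)) ∈ S →
                            valueOf is j ≤ valueOf is (suc j)
        weakly-increasing {d} {j} {β} {d′} {β′} m m′ = keyOf-≺⇒≤ d _ β d′ _ β′ (keys-ordered m m′ ≤-refl)

      descent⇒strict : ∀ {j d β d′ β′} → (d , just (suc j , β)) ∈ S → (d′ , just (suc (suc j) , β′)) ∈ S →
                       Des S (suc j) → valueOf is (suc j) < valueOf is (suc (suc j))
      descent⇒strict {j} {d} {β} {d′} {β′} m m′ des with m≤n⇒m<n∨m≡n (weakly-increasing m m′)
      ... | inj₁ strict = strict
      ... | inj₂ same with descent-inv m m′ des | keys-ordered m m′ ≤-refl
      ...   | inj₁ (refl , lower) | ordered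
        with refl , c≤c′ ← keyOf-≺-unprimed d (valueOf is (suc j)) d′ β′
                             (subst (λ v → T (keyOf d (valueOf is (suc j)) false ≺ᵇ keyOf d′ v β′)) (sym same) ordered)
        = ⊥-elim (unprimed-columns (∈-fill⁺ is m) (subst (λ v → (d′ , just (entry v false)) ∈ fill is S) (sym same) (∈-fill⁺ is m′))
                    (distinct-labels⇒distinct-dominoes m m′ (λ ())) (primed-correct m)
                    (consecutive-lower⇒shareCol m m′ c≤c′ lower))
      ...   | inj₂ (refl , notLower) | ordered
        with refl , r≤r′ ← keyOf-≺-primed d (valueOf is (suc j)) β d′
                             (subst (λ v → T (keyOf d (valueOf is (suc j)) β ≺ᵇ keyOf d′ v true)) (sym same) ordered)
        = ⊥-elim (primed-rows (∈-fill⁺ is m) (subst (λ v → (d′ , just (entry v true)) ∈ fill is S) (sym same) (∈-fill⁺ is m′))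
                    (distinct-labels⇒distinct-dominoes m m′ (λ ())) (primed-correct m)
                    (overlapping-rows⇒shareRow d d′ r≤r′ (≮⇒≥ notLower)))

      descent0⇒positive : 1 ≤ n → Des S 0 → 0 < valueOf is 1
      descent0⇒positive 1≤n des with d₁ , β₁ , m₁ ← label-exists (≤-refl , 1≤n) | valueOf is 1 in v₁≡
      ... | suc _ = z<s
      ... | zero with descent0-inv m₁ des
      ...   | inj₁ refl = case trans (sym (cong (λ v → primedB (entry v true)) v₁≡)) (primed-correct m₁) of λ ()
      ...   | inj₂ vertical = case trans (sym (zero-horizontal (subst (λ v → (d₁ , just (entry v β₁)) ∈ fill is S) v₁≡ (∈-fill⁺ is m₁))
                                                                 (label1-covers-origin m₁))) vertical of λ ()

      fbSeq : length is ≡ n → FBSeq (Des S) 0 0 is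
      fbSeq len = Equivalence.from (FBSeq⇔ (Des S) 0 0 is) (λ i i< → step i (subst (i <_) len i<))
        where
        step : ∀ i → i < n → FBStep (Des S) 0 (0 ∷ is) i
        step zero    0<n   = z≤n , descent0⇒positive 0<n
        step (suc j) j+1<n
          with d , β , m ← label-exists (s≤s z≤n , <⇒≤ j+1<n) | d′ , β′ , m′ ← label-exists (s≤s z≤n , j+1<n)
          = weakly-increasing m m′ , descent⇒strict m m′

    module Backward (len : length is ≡ n) (fb : FBSeq (Des S) 0 0 is) where

      open FBSequence len fb

      private
        run-of-equal-values : ∀ {k l d β} → (d , just (l , β)) ∈ S → k < l → valueOf is k ≡ valueOf is l →
                              NoDescentIn k l
        run-of-equal-values m′ _ = equal⇒noDescent (proj₂ (label-inRange m′))

      value0⇒unprimed : ∀ {d k β} → (d , just (k , β)) ∈ S → valueOf is k ≡ 0 → β ≡ false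
      value0⇒unprimed {d} {k} {β} m v≡0
        with 1≤k , k≤n ← label-inRange m
        with v₁≡0 ← n≤0⇒n≡0 (≤-trans (valueOf-mono 1≤k k≤n) (≤-reflexive v≡0))
        with d₁ , β₁ , m₁ ← label-exists (≤-refl , ≤-trans 1≤k k≤n)
        with β₁ | m₁ | m≤n⇒m<n∨m≡n 1≤k
      ... | true  | m₁ | _         = ⊥-elim (<-irrefl (sym v₁≡0) (proj₂ (step 0 (≤-trans 1≤k k≤n)) (inj₁ (d₁ , m₁))))
      ... | false | m₁ | inj₂ refl = sym (proj₂ (same-label⇒same-entry m₁ m))
      ... | false | m₁ | inj₁ 1<k  = proj₁ (unprimed-run ≤-refl (<⇒<′ 1<k) (run-of-equal-values m 1<k (trans v₁≡0 (sym v≡0))) m₁ m)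

      primed-correct : ∀ {d k β} → (d , just (k , β)) ∈ S → primedB (code k β) ≡ β
      primed-correct {k = k} {β} m with valueOf is k in v≡
      ... | zero  = sym (value0⇒unprimed m v≡)
      ... | suc v = primedB-entry v β

      ordered : Ordered
      ordered {d} {k} {β} {d′} {l} {β′} m m′ k<l =
        subst₂ (λ a b → T (a ≺ᵇ b)) (sym (key-entry d (valueOf is k) β (primed-correct m))) (sym (key-entry d′ (valueOf is l) β′ (primed-correct m′)))
          (byValue (m≤n⇒m<n∨m≡n (valueOf-mono (<⇒≤ k<l) (proj₂ (label-inRange m′)))))
        where
        byPrimes : ∀ v β β′ → (d , just (k , β)) ∈ S → (d′ , just (l , β′)) ∈ S → NoDescentIn k l →
                   T (keyOf d v β ≺ᵇ keyOf d′ v β′)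
        byPrimes v true  false _ _ _     = keyOf-≺-primed-unprimed d v d′
        byPrimes v false true  m m′ noDes with () ← proj₁ (unprimed-run (proj₁ (label-inRange m)) (<⇒<′ k<l) noDes m m′)
        byPrimes v true  true  m m′ noDes =
          keyOf-≺-primed-rows d v d′ (≤-<-trans (row≤bottomRow d) (proj₂ (primed-run (proj₁ (label-inRange m)) (<⇒<′ k<l) noDes m m′)))
        byPrimes v false false m m′ noDes =
          keyOf-≺-unprimed-cols d v d′ (≤-<-trans (col≤rightCol d) (proj₂ (unprimed-run (proj₁ (label-inRange m)) (<⇒<′ k<l) noDes m m′)))
        byValue : valueOf is k < valueOf is l ⊎ valueOf is k ≡ valueOf is l →
                  T (keyOf d (valueOf is k) β ≺ᵇ keyOf d′ (valueOf is l) β′)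
        byValue (inj₁ v<v′) = keyOf-≺-value d (valueOf is k) β d′ (valueOf is l) β′ v<v′
        byValue (inj₂ v≡v′) = subst (λ v → T (keyOf d (valueOf is k) β ≺ᵇ keyOf d′ v β′)) v≡v′
                                (byPrimes (valueOf is k) β β′ m m′ (run-of-equal-values m′ k<l v≡v′))

      correct : Correct
      correct m = ordered⇒rank ordered m , primed-correct m

      private
        fill-increasing : ∀ {d a e b} → (d , just a) ∈ fill is S → (e , just b) ∈ fill is S →
          (∀ {k β l β′} → (d , just (k , β)) ∈ S → (e , just (l , β′)) ∈ S → k < l) → a ≤ b
        fill-increasing {d} {e = e} m m′ increasing
          with k , β , mₛ , refl ← ∈-fill⁻ is m | l , β′ , mₛ′ , refl ← ∈-fill⁻ is m′
          = key-≺⇒≤ d (code k β) e (code l β′) (ordered mₛ mₛ′ (increasing mₛ mₛ′))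

        equal-entries : ∀ {d e a} → (d , just a) ∈ fill is S → (e , just a) ∈ fill is S →
          ∃[ k ] ∃[ l ] ∃[ β ] (d , just (k , β)) ∈ S × (e , just (l , β)) ∈ S × primedB a ≡ β × valueOf is k ≡ valueOf is l
        equal-entries m m′
          with k , β , mₛ , refl ← ∈-fill⁻ is m | l , β′ , mₛ′ , a≡ ← ∈-fill⁻ is m′
          with refl ← trans (sym (primed-correct mₛ′)) (trans (cong primedB (sym a≡)) (primed-correct mₛ))
          = k , l , β , mₛ , mₛ′ , primed-correct mₛ ,
            trans (sym (val-entry (valueOf is k) β)) (trans (cong val a≡) (val-entry (valueOf is l) β))

      fill-primed-rows : ∀ {d e a} → (d , just a) ∈ fill is S → (e , just a) ∈ fill is S → d ≢ e →
                         primedB a ≡ true → ¬ ShareRow d e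
      fill-primed-rows m m′ d≢e primed share with k , l , β , mₛ , mₛ′ , primed≡β , same ← equal-entries m m′
        with refl ← trans (sym primed≡β) primed
        with <-cmp k l
      ...   | tri< k<l _ _ = shareRow⇒¬lower share
                               (proj₂ (primed-run (proj₁ (label-inRange mₛ)) (<⇒<′ k<l) (run-of-equal-values mₛ′ k<l same) mₛ mₛ′))
      ...   | tri≈ _ refl _ = d≢e (proj₁ (same-label⇒same-entry mₛ mₛ′))
      ...   | tri> _ _ l<k = shareRow⇒¬lower (shareRow-sym share)
                               (proj₂ (primed-run (proj₁ (label-inRange mₛ′)) (<⇒<′ l<k) (run-of-equal-values mₛ l<k (sym same)) mₛ′ mₛ))

      fill-unprimed-columns : ∀ {d e a} → (d , just a) ∈ fill is S → (e , just a) ∈ fill is S → d ≢ e →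
                              primedB a ≡ false → ¬ ShareCol d e
      fill-unprimed-columns m m′ d≢e unprimed share with k , l , β , mₛ , mₛ′ , primed≡β , same ← equal-entries m m′
        with refl ← trans (sym primed≡β) unprimed
        with <-cmp k l
      ...   | tri< k<l _ _ = shareCol⇒¬right share
                               (proj₂ (unprimed-run (proj₁ (label-inRange mₛ)) (<⇒<′ k<l) (run-of-equal-values mₛ′ k<l same) mₛ mₛ′))
      ...   | tri≈ _ refl _ = d≢e (proj₁ (same-label⇒same-entry mₛ mₛ′))
      ...   | tri> _ _ l<k = shareCol⇒¬right (shareCol-sym share)
                               (proj₂ (unprimed-run (proj₁ (label-inRange mₛ′)) (<⇒<′ l<k) (run-of-equal-values mₛ l<k (sym same)) mₛ′ mₛ))

      fill-zero-horizontal : ∀ {d} → (d , just 0) ∈ fill is S → Covers d (0 , 0) → ori d ≡ hor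
      fill-zero-horizontal {d} m cv
        with k , β , mₛ , 0≡ ← ∈-fill⁻ is m
        with 1≤k , k≤n ← label-inRange mₛ
        with d₁ , β₁ , m₁ ← label-exists (≤-refl , ≤-trans 1≤k k≤n)
        with refl ← same-cell⇒same-entry mₛ m₁ cv (label1-covers-origin m₁)
        with ori d in o
      ... | hor = refl
      ... | ver = ⊥-elim (<-irrefl (sym (entry≡0⇒val≡0 (valueOf is 1) β₁ (sym 0≡)))
                                   (proj₂ (step 0 (≤-trans 1≤k k≤n)) (inj₂ (d , β₁ , mₛ , o))))

      tableau : SSShDT la (fill is S)
      tableau =
        ( (subst (Tiling la) (sym (tilingOf-fill is S)) tiling , subst ShiftedTiling (sym (tilingOf-fill is S)) shifted
          , labeledOK-fill is labeledOK)
        , (λ m m′ d≢e r c cv cv′ → fill-increasing m m′ (λ mₛ mₛ′ → rows-increase mₛ mₛ′ d≢e r c cv cv′))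
        , (λ m m′ d≢e r c cv cv′ → fill-increasing m m′ (λ mₛ mₛ′ → cols-increase mₛ mₛ′ d≢e r c cv cv′))
        , fill-primed-rows , fill-unprimed-columns , fill-zero-horizontal )

    wt-fill : length is ≡ n → ∀ v → wt (fill is S) v ≡ mult is v
    wt-fill len v = begin
      wt (fill is S) v                                           ≡⟨ wt-entries (fill is S) v ⟩
      countᵇ _ (entries (fill is S))                             ≡⟨ cong (countᵇ _) (entries-fill is S) ⟩
      countᵇ _ (map _ (entries S))                               ≡⟨ countᵇ-map _ _ (entries S) ⟩
      countᵇ _ (entries S)                                       ≡⟨ countᵇ-cong (entries S) (λ {(_ , k , β)} _ →
                                                                      cong (_≡ᵇ v) (val-entry (valueOf is k) β)) ⟩
      countᵇ (hit ∘ proj₁ ∘ proj₂) (entries S)                   ≡⟨ countᵇ-map hit _ (entries S) ⟨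
      countᵇ hit (map (proj₁ ∘ proj₂) (entries S))               ≡⟨ cong (countᵇ hit) (labels≡ S) ⟨
      countᵇ hit (labels S)                                      ≡⟨ countᵇ-enumeration hit labels-enumerate ⟩
      countᵇ hit (applyDownFrom suc n)                           ≡⟨ countᵇ-enumeration hit (applyUpTo-enumerates n) ⟨
      countᵇ hit (applyUpTo suc n)                               ≡⟨ countᵇ-map (_≡ᵇ v) (valueOf is) (applyUpTo suc n) ⟨
      countᵇ (_≡ᵇ v) (map (valueOf is) (applyUpTo suc n))        ≡⟨ cong (countᵇ (_≡ᵇ v)) (map-applyUpTo suc (valueOf is) n) ⟩
      countᵇ (_≡ᵇ v) (applyUpTo (valueOf is ∘ suc) n)            ≡⟨ cong (λ m → countᵇ (_≡ᵇ v) (applyUpTo (valueOf is ∘ suc) m)) len ⟨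
      countᵇ (_≡ᵇ v) (applyUpTo (valueOf is ∘ suc) (length is))  ≡⟨ cong (countᵇ (_≡ᵇ v)) (applyUpTo-valueOf is) ⟩
      countᵇ (_≡ᵇ v) is                                          ≡⟨ mult≡countᵇ is v ⟨
      mult is v                                                  ∎
      where
      open ≡-Reasoning
      hit : ℕ → Bool
      hit k = valueOf is k ≡ᵇ v

  readOff-sound : ∀ F → SSShDT la F × std F ≡ S →
                  FBIndex (Des S) n (readOff S F) × (∀ v → wt F v ≡ mult (readOff S F) v)
  readOff-sound F (tableau , std≡S) =
    (len , Forward.fbSeq (subst (SSShDT la) F≡ tableau) (std-fill⇒correct (subst (λ G → std G ≡ S) F≡ std≡S)) len) ,
    (λ v → trans (cong (λ G → wt G v) F≡) (wt-fill len v))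
    where
    open Filled (readOff S F)
    F≡ = fill-readOff F std≡S
    len = length-applyUpTo _ n

  readOff-injective : ∀ F F′ → SSShDT la F × std F ≡ S → SSShDT la F′ × std F′ ≡ S →
                      readOff S F ≡ readOff S F′ → F ≡ F′
  readOff-injective F F′ (_ , std≡S) (_ , std′≡S) same =
    trans (fill-readOff F std≡S) (trans (cong (λ is → fill is S) same) (sym (fill-readOff F′ std′≡S)))

  readOff-surjective : ∀ is → FBIndex (Des S) n is → ∃ λ F → (SSShDT la F × std F ≡ S) × readOff S F ≡ is
  readOff-surjective is (len , fb) = fill is S , (tableau , correct⇒std-fill correct) , readOff-fill is len
    where
    open Filled is
    open Backward len fb

theorem4p6 : (la : List ℕ) → IsPartition la → ShiftedQuotient la →
    (S : Filling MLabel) → MSShDT la S →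
    GFEq (λ T → SSShDT la T × std T ≡ S) (FBIndex (Des S) (nDominoes S)) wt mult
theorem4p6 la partition _ S ((tiling , shifted , labeledOK) , inRange , unique , rows , cols) =
  readOff S , readOff-sound , readOff-injective , readOff-surjective
  where open Standardization partition tiling shifted labeledOK inRange unique rows cols
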